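{- Let $\mathbf{P}=(S,\mathcal{L})$ be the projective space of a vector space $V$ over a field of characteristic different from $2$, let $\varkappa$ be a symplectic quasi-correlation of $\mathbf{P}$, let $\mathfrak{M}=\mathbf{V}_2(\mathbf{P})$, and let $\mathcal{H}=\{x+y : x\in S,\ y\in\varkappa(x)\}$. Then the structure $\mathfrak{A}=\mathfrak{M}\setminus\mathcal{H}$ satisfies the Tamaschke Bedingung and the Parallelogram Completion Condition.
   Context: The points of $\mathbf{P}$ are the $1$-dimensional subspaces $\langle v\rangle$ of $V$, its lines are the point sets of $2$-dimensional subspaces. A quasi-correlation $\varkappa$ is given by a nonzero reflexive sesquilinear form $\xi$ on $V$ via $\varkappa(\langle v\rangle)=\{\langle u\rangle:\xi(u,v)=0\}$; it is symplectic if $p\in\varkappa(p)$ for every point $p$. The Veronese space $\mathbf{V}_2(\mathbf{P})$ has as points all multisets $x+y$ ($x,y\in S$, $2x=x+x$) and as lines all $x+L=\{x+y:y\in L\}$ ($x\in S$, $L\in\mathcal{L}$) and $2L=\{2y:y\in L\}$. The set $\mathcal{H}$ is a hyperplane (proper subspace meeting every line) of $\mathfrak{M}$. The reduct $\mathfrak{A}=\mathfrak{M}\setminus\mathcal{H}$ has point set $\mathfrak{y}_2(S)\setminus\mathcal{H}$ (where $\mathfrak{y}_2(S)$ is the set of all $x+y$), line set $\{L\setminus\mathcal{H} : L \text{ a line of } \mathfrak{M},\ L\not\subseteq\mathcal{H}\}$, and parallelism $\parallel_{\mathcal{H}}$ given by $L_1\setminus\mathcal{H}\parallel_{\mathcal{H}}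 L_2\setminus\mathcal{H}$ iff $L_1\cap\mathcal{H}=L_2\cap\mathcal{H}$. Tamaschke Bedingung: if a line parallel to one side of a triangle (three pairwise collinear points not on a common line, with the three joining lines as sides) crosses a second side, then it crosses the third side as well. Parallelogram Completion Condition: if $L_1\parallel L_2$ and $K_1\parallel K_2$ with no $L_i$ parallel to any $K_j$, and three of the four pairs $(L_i,K_j)$ intersect, then the fourth pair intersects as well. -}

module Defs where

open import Level using (Level; _⊔_)
open import Algebra.Bundles using (CommutativeRing)
open import Algebra.Module.Bundles using (Module)
open import Data.Product using (Σ; ∃; ∃₂; _×_; _,_; proj₁; proj₂)
open import Data.Sum using (_⊎_)
open import Relation.Nullary using (¬_)

module _ {r ℓr : Level} (R : CommutativeRing r ℓr) where
  open CommutativeRing R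

  record IsField : Set (r ⊔ ℓr) where
    field
      1≉0     : ¬ (1# ≈ 0#)
      inverse : ∀ x → ¬ (x ≈ 0#) → ∃ λ y → x * y ≈ 1#

  CharNot2 : Set ℓr
  CharNot2 = ¬ (1# + 1# ≈ 0#)

  record IsFieldAutomorphism (σ : Carrier → Carrier) : Set (r ⊔ ℓr) where
    field
      σ-cong     : ∀ {x y} → x ≈ y → σ x ≈ σ y
      σ-+        : ∀ x y → σ (x + y) ≈ σ x + σ y
      σ-*        : ∀ x y → σ (x * y) ≈ σ x * σ y
      σ-1        : σ 1# ≈ 1#
      injective  : ∀ {x y} → σ x ≈ σ y → x ≈ y
      surjective : ∀ y → ∃ λ x → σ x ≈ y

  module _ {m ℓm : Level} (M : Module R m ℓm) where
    open Module M

    record IsSesquilinear (σ : Carrier → Carrier)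
                          (ξ : Carrierᴹ → Carrierᴹ → Carrier) : Set (r ⊔ ℓr ⊔ m ⊔ ℓm) where
      field
        ξ-cong  : ∀ {u u′ v v′} → u ≈ᴹ u′ → v ≈ᴹ v′ → ξ u v ≈ ξ u′ v′
        ξ-+ˡ    : ∀ u u′ v → ξ (u +ᴹ u′) v ≈ ξ u v + ξ u′ v
        ξ-*ˡ    : ∀ a u v → ξ (a *ₗ u) v ≈ a * ξ u v
        ξ-+ʳ    : ∀ u v v′ → ξ u (v +ᴹ v′) ≈ ξ u v + ξ u v′
        ξ-*ʳ    : ∀ a u v → ξ u (a *ₗ v) ≈ ξ u v * σ a

    IsReflexiveForm : (Carrierᴹ → Carrierᴹ → Carrier) → Set (m ⊔ ℓr)
    IsReflexiveForm ξ = ∀ u v → ξ u v ≈ 0# → ξ v u ≈ 0#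

    IsNonzeroForm : (Carrierᴹ → Carrierᴹ → Carrier) → Set (m ⊔ ℓr)
    IsNonzeroForm ξ = ∃₂ λ u v → ¬ (ξ u v ≈ 0#)

    -- a point ⟨v⟩ is represented by a nonzero vector v
    Point : Set (m ⊔ ℓm)
    Point = Σ Carrierᴹ (λ v → ¬ (v ≈ᴹ 0ᴹ))

    vec : Point → Carrierᴹ
    vec = proj₁

    _≐_ : Point → Point → Set (r ⊔ ℓm)
    p ≐ q = ∃ λ a → vec p ≈ᴹ a *ₗ vec q

    -- a line is the point set of a 2-dimensional subspace ⟨a, b⟩
    record PLine : Set (r ⊔ m ⊔ ℓm) where
      field
        pa pb : Point
        independent : ¬ (pa ≐ pb)

    _onP_ : Point → PLine → Set (r ⊔ ℓm)
    p onP L = ∃₂ λ α β → vec p ≈ᴹ (α *ₗ vec (PLine.pa L)) +ᴹ (β *ₗ vec (PLine.pb L))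

    -- the multiset x + y
    VPoint : Set (m ⊔ ℓm)
    VPoint = Point × Point

    _≑_ : VPoint → VPoint → Set (r ⊔ ℓm)
    (x , y) ≑ (x′ , y′) = ((x ≐ x′) × (y ≐ y′)) ⊎ ((x ≐ y′) × (y ≐ x′))

    -- lines x + L and 2L
    data VLine : Set (r ⊔ m ⊔ ℓm) where
      _⊕_    : Point → PLine → VLine
      double : PLine → VLine

    _∈V_ : VPoint → VLine → Set (r ⊔ m ⊔ ℓm)
    P ∈V (x ⊕ L)    = ∃ λ y → (y onP L) × (P ≑ (x , y))
    P ∈V (double L) = ∃ λ y → (y onP L) × (P ≑ (y , y))

    module Reduct (ξ : Carrierᴹ → Carrierᴹ → Carrier) where

      -- ⟨u⟩ ∈ κ(⟨v⟩)  iff  ξ(u,v) = 0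
      _∈κ_ : Point → Point → Set ℓr
      u ∈κ v = ξ (vec u) (vec v) ≈ 0#

      IsSymplectic : Set (m ⊔ ℓm ⊔ ℓr)
      IsSymplectic = ∀ p → p ∈κ p

      ℋ : VPoint → Set (r ⊔ m ⊔ ℓm ⊔ ℓr)
      ℋ P = ∃₂ λ x y → (y ∈κ x) × (P ≑ (x , y))

      APoint : Set (r ⊔ m ⊔ ℓm ⊔ ℓr)
      APoint = Σ VPoint (λ P → ¬ ℋ P)

      -- lines of 𝔄: L ∖ ℋ for lines L of 𝔐 with L ⊈ ℋ
      ALine : Set (r ⊔ m ⊔ ℓm ⊔ ℓr)
      ALine = Σ VLine (λ ℓ → ∃ λ P → (P ∈V ℓ) × ¬ ℋ P)

      _on_ : APoint → ALine → Set (r ⊔ m ⊔ ℓm)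
      p on ℓ = proj₁ p ∈V proj₁ ℓ

      _∥_ : ALine → ALine → Set (r ⊔ m ⊔ ℓm ⊔ ℓr)
      ℓ₁ ∥ ℓ₂ = ∀ P → ℋ P → ((P ∈V proj₁ ℓ₁ → P ∈V proj₁ ℓ₂) × (P ∈V proj₁ ℓ₂ → P ∈V proj₁ ℓ₁))

      Meet : ALine → ALine → Set (r ⊔ m ⊔ ℓm ⊔ ℓr)
      Meet ℓ₁ ℓ₂ = ∃ λ p → (p on ℓ₁) × (p on ℓ₂)

      Collinear3 : APoint → APoint → APoint → Set (r ⊔ m ⊔ ℓm ⊔ ℓr)
      Collinear3 a b c = ∃ λ ℓ → (a on ℓ) × (b on ℓ) × (c on ℓ)

      TamaschkeBedingung : Set (r ⊔ m ⊔ ℓm ⊔ ℓr)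
      TamaschkeBedingung =
        ∀ (a b c : APoint) (A B C : ALine) →
        b on A → c on A → a on B → c on B → a on C → b on C →
        ¬ Collinear3 a b c →
        ∀ (K : ALine) → K ∥ C → Meet K B → Meet K A

      ParallelogramCompletion : Set (r ⊔ m ⊔ ℓm ⊔ ℓr)
      ParallelogramCompletion =
        ∀ (L₁ L₂ K₁ K₂ : ALine) → L₁ ∥ L₂ → K₁ ∥ K₂ →
        ¬ (L₁ ∥ K₁) → ¬ (L₁ ∥ K₂) → ¬ (L₂ ∥ K₁) → ¬ (L₂ ∥ K₂) →
        Meet L₁ K₁ → Meet L₁ K₂ → Meet L₂ K₁ → Meet L₂ K₂

module Submission where

-- Since ξ is symplectic every point 2y lies in ℋ, so every line of 𝔄 is of the
-- form x ⊕ L with some y ∈ L, ξ(y,x) ≠ 0.  The linear functional ξ(-,x) then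
-- vanishes at exactly one point h(x,L) of L, the polar point; x + h(x,L) is
-- the unique point of ℋ on x ⊕ L, so two lines of 𝔄 are parallel as soon as
-- their polar sums agree.  Two lines x ⊕ M and z ⊕ N of 𝔄 meet iff either
-- x = z and M, N share a point not orthogonal to x, or x ∈ N, z ∈ M and
-- ξ(x,z) ≠ 0 ("crossing data").  Both conditions are then proved by
-- classifying how the given incidences are realised by representatives of
-- the multisets: most configurations contradict ξ(y,x) ≠ 0 off ℋ, and the
-- remaining ones reduce to linear algebra in a projective plane (two lines of
-- a plane meet; a point orthogonal to x on a line is unique).

open import Defs
open import Level using (Level; _⊔_)
open import Algebra.Bundles using (CommutativeRing)
open import Algebra.Module.Bundles using (Module)
open import Data.Product using (_×_; Σ; ∃; ∃₂; _,_; proj₁; proj₂)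
open import Data.Sum using (_⊎_; inj₁; inj₂)
open import Data.Empty using (⊥; ⊥-elim)
open import Relation.Nullary using (¬_)
open import Data.Integer using (+_)
import Relation.Binary.Reasoning.Setoid as SetoidReasoning

-- The standard library's
-- `Algebra.Solver.Ring` needs a coefficient ring with decidable equality and
-- a homomorphism into R; we take ℤ with its canonical map n ↦ n·1.
module IntegerSolver {r ℓ} (R : CommutativeRing r ℓ) where

  open import Data.Nat as ℕ using (ℕ; zero; suc)
  import Data.Nat.Properties as ℕP
  open import Data.Integer as ℤ using (ℤ; -[1+_]; _⊖_)
  import Data.Integer.Properties as ℤP
  open import Data.Sign as Sign using (Sign)
  open import Data.Maybe using (Maybe; just; nothing)
  open import Relation.Nullary using (yes; no)
  open import Relation.Binary.PropositionalEquality as P using (_≡_)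
  import Algebra.Solver.Ring.AlmostCommutativeRing as ACR
  open CommutativeRing R
  open import Algebra.Properties.Semiring.Mult.TCOptimised semiring using (×-homo-+; ×1-homo-*) renaming (_×_ to _⊠_)
  open import Algebra.Properties.Group +-group using (ε⁻¹≈ε; ⁻¹-involutive)
  open import Algebra.Properties.AbelianGroup +-abelianGroup using (⁻¹-∙-comm)
  open import Algebra.Properties.Ring ring using (-‿distribˡ-*; -‿distribʳ-*)
  open SetoidReasoning setoid

  fromℤ : ℤ → Carrier
  fromℤ (+ n)      = n ⊠ 1#
  fromℤ (-[1+ n ]) = - (suc n ⊠ 1#)

  fromℤ-⊖ : ∀ m n → fromℤ (m ⊖ n) ≈ m ⊠ 1# + - (n ⊠ 1#)
  fromℤ-⊖ zero zero = begin
    0#          ≈⟨ sym (+-identityʳ 0#) ⟩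
    0# + 0#     ≈⟨ +-congˡ (sym ε⁻¹≈ε) ⟩
    0# + - 0#   ∎
  fromℤ-⊖ zero (suc n) = sym (+-identityˡ _)
  fromℤ-⊖ (suc m) zero = begin
    suc m ⊠ 1#            ≈⟨ sym (+-identityʳ _) ⟩
    suc m ⊠ 1# + 0#       ≈⟨ +-congˡ (sym ε⁻¹≈ε) ⟩
    suc m ⊠ 1# + - 0#     ∎
  fromℤ-⊖ (suc m) (suc n) = begin
    fromℤ (suc m ⊖ suc n)                 ≡⟨ P.cong fromℤ (ℤP.[1+m]⊖[1+n]≡m⊖n m n) ⟩
    fromℤ (m ⊖ n)                         ≈⟨ fromℤ-⊖ m n ⟩
    m ⊠ 1# + - (n ⊠ 1#)                   ≈⟨ sym (+-identityˡ _) ⟩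
    0# + (m ⊠ 1# + - (n ⊠ 1#))            ≈⟨ +-congʳ (sym (-‿inverseʳ 1#)) ⟩
    (1# + - 1#) + (m ⊠ 1# + - (n ⊠ 1#))   ≈⟨ +-assoc 1# (- 1#) _ ⟩
    1# + (- 1# + (m ⊠ 1# + - (n ⊠ 1#)))   ≈⟨ +-congˡ (sym (+-assoc (- 1#) _ _)) ⟩
    1# + ((- 1# + m ⊠ 1#) + - (n ⊠ 1#))   ≈⟨ +-congˡ (+-congʳ (+-comm (- 1#) _)) ⟩
    1# + ((m ⊠ 1# + - 1#) + - (n ⊠ 1#))   ≈⟨ +-congˡ (+-assoc _ _ _) ⟩
    1# + (m ⊠ 1# + (- 1# + - (n ⊠ 1#)))   ≈⟨ +-congˡ (+-congˡ (⁻¹-∙-comm 1# _)) ⟩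
    1# + (m ⊠ 1# + - (1# + n ⊠ 1#))       ≈⟨ sym (+-assoc _ _ _) ⟩
    (1# + m ⊠ 1#) + - (1# + n ⊠ 1#)       ≈⟨ +-cong (sym (×-homo-+ 1# 1 m)) (-‿cong (sym (×-homo-+ 1# 1 n))) ⟩
    suc m ⊠ 1# + - (suc n ⊠ 1#)           ∎

  fromℤ-+ : ∀ i j → fromℤ (i ℤ.+ j) ≈ fromℤ i + fromℤ j
  fromℤ-+ (+ m) (+ n) = ×-homo-+ 1# m n
  fromℤ-+ (+ m) -[1+ n ] = fromℤ-⊖ m (suc n)
  fromℤ-+ -[1+ m ] (+ n) = trans (fromℤ-⊖ n (suc m)) (+-comm _ _)
  fromℤ-+ -[1+ m ] -[1+ n ] = begin
    - (suc (suc (m ℕ.+ n)) ⊠ 1#)      ≡⟨ P.cong (λ k → - (k ⊠ 1#)) (P.sym (ℕP.+-suc (suc m) n)) ⟩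
    - ((suc m ℕ.+ suc n) ⊠ 1#)        ≈⟨ -‿cong (×-homo-+ 1# (suc m) (suc n)) ⟩
    - (suc m ⊠ 1# + suc n ⊠ 1#)       ≈⟨ sym (⁻¹-∙-comm _ _) ⟩
    - (suc m ⊠ 1#) + - (suc n ⊠ 1#)   ∎

  -- multiplication is handled through the sign/absolute value decomposition
  signed : Sign → Carrier → Carrier
  signed Sign.+ x = x
  signed Sign.- x = - x

  signed-cong : ∀ s {a b} → a ≈ b → signed s a ≈ signed s b
  signed-cong Sign.+ e = e
  signed-cong Sign.- e = -‿cong e

  fromℤ-◃ : ∀ s n → fromℤ (s ℤ.◃ n) ≈ signed s (n ⊠ 1#)
  fromℤ-◃ Sign.+ zero    = refl
  fromℤ-◃ Sign.- zero    = sym ε⁻¹≈ε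
  fromℤ-◃ Sign.+ (suc n) = refl
  fromℤ-◃ Sign.- (suc n) = refl

  signed-* : ∀ s t a b → signed (s Sign.* t) (a * b) ≈ signed s a * signed t b
  signed-* Sign.+ Sign.+ a b = refl
  signed-* Sign.+ Sign.- a b = -‿distribʳ-* a b
  signed-* Sign.- Sign.+ a b = -‿distribˡ-* a b
  signed-* Sign.- Sign.- a b = begin
    a * b           ≈⟨ sym (⁻¹-involutive _) ⟩
    - - (a * b)     ≈⟨ -‿cong (-‿distribˡ-* a b) ⟩
    - (- a * b)     ≈⟨ -‿distribʳ-* (- a) b ⟩
    - a * - b       ∎

  fromℤ-sign-abs : ∀ i → fromℤ i ≈ signed (ℤ.sign i) (ℤ.∣ i ∣ ⊠ 1#)
  fromℤ-sign-abs (+ zero)  = refl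
  fromℤ-sign-abs (+ suc n) = refl
  fromℤ-sign-abs -[1+ n ]  = refl

  fromℤ-* : ∀ i j → fromℤ (i ℤ.* j) ≈ fromℤ i * fromℤ j
  fromℤ-* i j = begin
    fromℤ (i ℤ.* j)
      ≈⟨ fromℤ-◃ (ℤ.sign i Sign.* ℤ.sign j) (ℤ.∣ i ∣ ℕ.* ℤ.∣ j ∣) ⟩
    signed (ℤ.sign i Sign.* ℤ.sign j) ((ℤ.∣ i ∣ ℕ.* ℤ.∣ j ∣) ⊠ 1#)
      ≈⟨ signed-cong (ℤ.sign i Sign.* ℤ.sign j) (×1-homo-* ℤ.∣ i ∣ ℤ.∣ j ∣) ⟩
    signed (ℤ.sign i Sign.* ℤ.sign j) ((ℤ.∣ i ∣ ⊠ 1#) * (ℤ.∣ j ∣ ⊠ 1#))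
      ≈⟨ signed-* (ℤ.sign i) (ℤ.sign j) _ _ ⟩
    signed (ℤ.sign i) (ℤ.∣ i ∣ ⊠ 1#) * signed (ℤ.sign j) (ℤ.∣ j ∣ ⊠ 1#)
      ≈⟨ *-cong (sym (fromℤ-sign-abs i)) (sym (fromℤ-sign-abs j)) ⟩
    fromℤ i * fromℤ j
      ∎

  fromℤ-neg : ∀ i → fromℤ (ℤ.- i) ≈ - fromℤ i
  fromℤ-neg (+ zero)  = sym ε⁻¹≈ε
  fromℤ-neg (+ suc n) = refl
  fromℤ-neg -[1+ n ]  = sym (⁻¹-involutive _)

  fromℤ-hom : ℤ.+-*-rawRing ACR.-Raw-AlmostCommutative⟶ ACR.fromCommutativeRing R
  fromℤ-hom = record
    { ⟦_⟧ = fromℤ ; +-homo = fromℤ-+ ; *-homo = fromℤ-* ; -‿homo = fromℤ-neg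
    ; 0-homo = refl ; 1-homo = refl }

  -- equal integer coefficients have equal images (all the solver needs)
  fromℤ-≟ : ∀ i j → Maybe (fromℤ i ≈ fromℤ j)
  fromℤ-≟ i j with i ℤ.≟ j
  ... | yes P.refl = just refl
  ... | no _       = nothing

  open import Algebra.Solver.Ring ℤ.+-*-rawRing (ACR.fromCommutativeRing R) fromℤ-hom fromℤ-≟ public

-- The parameters are the data of Proposition 2.11 that
-- the proof uses: a field R, a vector space M, and a reflexive symplectic
-- σ-sesquilinear form ξ (σ is only needed to state sesquilinearity).
module Geometry {r ℓr m ℓm : Level} (R : CommutativeRing r ℓr) (fld : IsField R)
   (M : Module R m ℓm)
   (σ : CommutativeRing.Carrier R → CommutativeRing.Carrier R)
   (ξ : Module.Carrierᴹ M → Module.Carrierᴹ M → CommutativeRing.Carrier R)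
   (ses : IsSesquilinear R M σ ξ) (rflx : IsReflexiveForm R M ξ)
   (symp : Reduct.IsSymplectic R M ξ) where

  open CommutativeRing R
  open Module M
  open IsField fld
  open IsSesquilinear ses
  open Reduct R M ξ
  open IntegerSolver R using (solve; _:=_; _:+_; _:*_; :-_; con)
  open import Algebra.Properties.Group +-group using (ε⁻¹≈ε; inverseˡ-unique; ⁻¹-involutive)

  V : Set m
  V = Carrierᴹ

  Pt : Set (m ⊔ ℓm)
  Pt = Point R M

  PL : Set (r ⊔ m ⊔ ℓm)
  PL = PLine R M

  VP : Set (m ⊔ ℓm)
  VP = VPoint R M

  vc : Pt → V
  vc = proj₁

  inverseˡ : ∀ c → ¬ c ≈ 0# → Σ Carrier λ c⁻¹ → c⁻¹ * c ≈ 1#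
  inverseˡ c c≉0 with inverse c c≉0
  ... | c⁻¹ , cc⁻¹ = c⁻¹ , trans (*-comm c⁻¹ c) cc⁻¹

  cancelʳ : ∀ {a c} → a * c ≈ 0# → ¬ c ≈ 0# → a ≈ 0#
  cancelʳ {a} {c} ac≈0 c≉0 with inverse c c≉0
  ... | c⁻¹ , cc⁻¹ = begin
      a                ≈⟨ sym (*-identityʳ a) ⟩
      a * 1#           ≈⟨ *-congˡ (sym cc⁻¹) ⟩
      a * (c * c⁻¹)    ≈⟨ sym (*-assoc a c c⁻¹) ⟩
      (a * c) * c⁻¹    ≈⟨ *-congʳ ac≈0 ⟩
      0# * c⁻¹         ≈⟨ zeroˡ c⁻¹ ⟩
      0#               ∎
    where open SetoidReasoning setoid

  cancelˡ : ∀ {a c} → c * a ≈ 0# → ¬ c ≈ 0# → a ≈ 0#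
  cancelˡ e c≉0 = cancelʳ (trans (*-comm _ _) e) c≉0

  -‿nonzero : ∀ {a} → ¬ a ≈ 0# → ¬ - a ≈ 0#
  -‿nonzero {a} a≉0 -a≈0 = a≉0 (trans (sym (⁻¹-involutive a)) (trans (-‿cong -a≈0) ε⁻¹≈ε))

  *-inverse-cancel : ∀ {x i c} → i * c ≈ 1# → x * i * c ≈ x
  *-inverse-cancel {x} {i} {c} e = trans (*-assoc x i c) (trans (*-congˡ e) (*-identityʳ x))

  lc2 : V → V → Carrier → Carrier → V
  lc2 P Q a b = a *ₗ P +ᴹ b *ₗ Q

  lc2-cong : ∀ {P Q a b a′ b′} → a ≈ a′ → b ≈ b′ → lc2 P Q a b ≈ᴹ lc2 P Q a′ b′
  lc2-cong e₁ e₂ = +ᴹ-cong (*ₗ-congʳ e₁) (*ₗ-congʳ e₂)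

  +ᴹ-interchange : ∀ p q s t → (p +ᴹ q) +ᴹ (s +ᴹ t) ≈ᴹ (p +ᴹ s) +ᴹ (q +ᴹ t)
  +ᴹ-interchange p q s t = begin
    (p +ᴹ q) +ᴹ (s +ᴹ t)   ≈⟨ +ᴹ-assoc p q (s +ᴹ t) ⟩
    p +ᴹ (q +ᴹ (s +ᴹ t))   ≈⟨ +ᴹ-congˡ (≈ᴹ-sym (+ᴹ-assoc q s t)) ⟩
    p +ᴹ ((q +ᴹ s) +ᴹ t)   ≈⟨ +ᴹ-congˡ (+ᴹ-congʳ (+ᴹ-comm q s)) ⟩
    p +ᴹ ((s +ᴹ q) +ᴹ t)   ≈⟨ +ᴹ-congˡ (+ᴹ-assoc s q t) ⟩
    p +ᴹ (s +ᴹ (q +ᴹ t))   ≈⟨ ≈ᴹ-sym (+ᴹ-assoc p s (q +ᴹ t)) ⟩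
    (p +ᴹ s) +ᴹ (q +ᴹ t)   ∎
    where open SetoidReasoning ≈ᴹ-setoid

  *ₗ-collect : ∀ c a d b P → c *ₗ (a *ₗ P) +ᴹ d *ₗ (b *ₗ P) ≈ᴹ (c * a + d * b) *ₗ P
  *ₗ-collect c a d b P = begin
    c *ₗ (a *ₗ P) +ᴹ d *ₗ (b *ₗ P)   ≈⟨ +ᴹ-cong (≈ᴹ-sym (*ₗ-assoc c a P)) (≈ᴹ-sym (*ₗ-assoc d b P)) ⟩
    (c * a) *ₗ P +ᴹ (d * b) *ₗ P     ≈⟨ ≈ᴹ-sym (*ₗ-distribʳ P (c * a) (d * b)) ⟩
    (c * a + d * b) *ₗ P             ∎
    where open SetoidReasoning ≈ᴹ-setoid

  lc2-combine : ∀ P Q c d a b a′ b′ →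
                c *ₗ lc2 P Q a b +ᴹ d *ₗ lc2 P Q a′ b′ ≈ᴹ lc2 P Q (c * a + d * a′) (c * b + d * b′)
  lc2-combine P Q c d a b a′ b′ = begin
    c *ₗ (a *ₗ P +ᴹ b *ₗ Q) +ᴹ d *ₗ (a′ *ₗ P +ᴹ b′ *ₗ Q)
      ≈⟨ +ᴹ-cong (*ₗ-distribˡ c _ _) (*ₗ-distribˡ d _ _) ⟩
    (c *ₗ (a *ₗ P) +ᴹ c *ₗ (b *ₗ Q)) +ᴹ (d *ₗ (a′ *ₗ P) +ᴹ d *ₗ (b′ *ₗ Q))
      ≈⟨ +ᴹ-interchange _ _ _ _ ⟩
    (c *ₗ (a *ₗ P) +ᴹ d *ₗ (a′ *ₗ P)) +ᴹ (c *ₗ (b *ₗ Q) +ᴹ d *ₗ (b′ *ₗ Q))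
      ≈⟨ +ᴹ-cong (*ₗ-collect c a d a′ P) (*ₗ-collect c b d b′ Q) ⟩
    lc2 P Q (c * a + d * a′) (c * b + d * b′)
      ∎
    where open SetoidReasoning ≈ᴹ-setoid

  lc2-scale : ∀ P Q c a b → c *ₗ lc2 P Q a b ≈ᴹ lc2 P Q (c * a) (c * b)
  lc2-scale P Q c a b = ≈ᴹ-trans (*ₗ-distribˡ c _ _) (+ᴹ-cong (≈ᴹ-sym (*ₗ-assoc c a P)) (≈ᴹ-sym (*ₗ-assoc c b Q)))

  lc2-zero : ∀ {P Q a b} → a ≈ 0# → b ≈ 0# → lc2 P Q a b ≈ᴹ 0ᴹ
  lc2-zero {P} {Q} a≈0 b≈0 = begin
    lc2 P Q _ _            ≈⟨ lc2-cong a≈0 b≈0 ⟩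
    0# *ₗ P +ᴹ 0# *ₗ Q     ≈⟨ +ᴹ-cong (*ₗ-zeroˡ P) (*ₗ-zeroˡ Q) ⟩
    0ᴹ +ᴹ 0ᴹ               ≈⟨ +ᴹ-identityˡ 0ᴹ ⟩
    0ᴹ                     ∎
    where open SetoidReasoning ≈ᴹ-setoid

  lc2-0ˡ : ∀ P Q {a} b → a ≈ 0# → lc2 P Q a b ≈ᴹ b *ₗ Q
  lc2-0ˡ P Q b e = ≈ᴹ-trans (+ᴹ-congʳ (≈ᴹ-trans (*ₗ-congʳ e) (*ₗ-zeroˡ P))) (+ᴹ-identityˡ _)

  lc2-0ʳ : ∀ P Q a {b} → b ≈ 0# → lc2 P Q a b ≈ᴹ a *ₗ P
  lc2-0ʳ P Q a e = ≈ᴹ-trans (+ᴹ-congˡ (≈ᴹ-trans (*ₗ-congʳ e) (*ₗ-zeroˡ Q))) (+ᴹ-identityʳ _)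

  lc2-unitˡ : ∀ P Q → P ≈ᴹ lc2 P Q 1# 0#
  lc2-unitˡ P Q = ≈ᴹ-sym (≈ᴹ-trans (lc2-0ʳ P Q 1# refl) (*ₗ-identityˡ P))

  lc2-swap : ∀ P Q a b → lc2 P Q a b ≈ᴹ lc2 Q P b a
  lc2-swap P Q a b = +ᴹ-comm _ _

  solve-for-first : ∀ {P Q α β} → lc2 P Q α β ≈ᴹ 0ᴹ → ¬ α ≈ 0# → ∃ λ k → P ≈ᴹ k *ₗ Q
  solve-for-first {P} {Q} {α} {β} e α≉0 = - (α⁻¹ * β) , (begin
      P                                                 ≈⟨ lc2-unitˡ P Q ⟩
      lc2 P Q 1# 0#                                     ≈⟨ ≈ᴹ-sym (+ᴹ-identityʳ _) ⟩
      lc2 P Q 1# 0# +ᴹ 0ᴹ                               ≈⟨ +ᴹ-cong (≈ᴹ-sym (*ₗ-identityˡ _)) (≈ᴹ-sym (≈ᴹ-trans (*ₗ-congˡ e) (*ₗ-zeroʳ _))) ⟩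
      1# *ₗ lc2 P Q 1# 0# +ᴹ (- α⁻¹) *ₗ lc2 P Q α β     ≈⟨ lc2-combine P Q 1# (- α⁻¹) 1# 0# α β ⟩
      lc2 P Q (1# * 1# + - α⁻¹ * α) (1# * 0# + - α⁻¹ * β)
        ≈⟨ lc2-0ˡ P Q _ (trans (solve 2 (λ i a → con (+ 1) :* con (+ 1) :+ :- i :* a := con (+ 1) :+ :- (i :* a)) refl α⁻¹ α)
                               (trans (+-congˡ (-‿cong α⁻¹α)) (-‿inverseʳ 1#))) ⟩
      (1# * 0# + - α⁻¹ * β) *ₗ Q                         ≈⟨ *ₗ-congʳ (solve 2 (λ i b → con (+ 1) :* con (+ 0) :+ :- i :* b := :- (i :* b)) refl α⁻¹ β) ⟩
      (- (α⁻¹ * β)) *ₗ Q                                 ∎)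
    where
    open SetoidReasoning ≈ᴹ-setoid
    α⁻¹ = proj₁ (inverseˡ α α≉0)
    α⁻¹α = proj₂ (inverseˡ α α≉0)

  -- Elimination of the common vector A: if h = γA + δB and u = αA + βC then
  -- αh − γu involves only B and C.  This is the computation behind "two
  -- lines of a plane meet".
  eliminate : ∀ A B C γ δ α β →
              α *ₗ lc2 A B γ δ +ᴹ (- γ) *ₗ lc2 A C α β ≈ᴹ lc2 B C (α * δ) (- γ * β)
  eliminate A B C γ δ α β = begin
    α *ₗ (γ *ₗ A +ᴹ δ *ₗ B) +ᴹ (- γ) *ₗ (α *ₗ A +ᴹ β *ₗ C)
      ≈⟨ +ᴹ-cong (*ₗ-distribˡ α _ _) (*ₗ-distribˡ (- γ) _ _) ⟩
    (α *ₗ (γ *ₗ A) +ᴹ α *ₗ (δ *ₗ B)) +ᴹ ((- γ) *ₗ (α *ₗ A) +ᴹ (- γ) *ₗ (β *ₗ C))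
      ≈⟨ +ᴹ-interchange _ _ _ _ ⟩
    (α *ₗ (γ *ₗ A) +ᴹ (- γ) *ₗ (α *ₗ A)) +ᴹ (α *ₗ (δ *ₗ B) +ᴹ (- γ) *ₗ (β *ₗ C))
      ≈⟨ +ᴹ-cong (*ₗ-collect α γ (- γ) α A) (+ᴹ-cong (≈ᴹ-sym (*ₗ-assoc α δ B)) (≈ᴹ-sym (*ₗ-assoc (- γ) β C))) ⟩
    (α * γ + - γ * α) *ₗ A +ᴹ lc2 B C (α * δ) (- γ * β)
      ≈⟨ +ᴹ-congʳ (≈ᴹ-trans (*ₗ-congʳ (solve 2 (λ a g → a :* g :+ :- g :* a := con (+ 0)) refl α γ)) (*ₗ-zeroˡ A)) ⟩
    0ᴹ +ᴹ lc2 B C (α * δ) (- γ * β)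
      ≈⟨ +ᴹ-identityˡ _ ⟩
    lc2 B C (α * δ) (- γ * β)
      ∎
    where open SetoidReasoning ≈ᴹ-setoid

  Z : V → V → Set ℓr
  Z u v = ξ u v ≈ 0#

  Z-0ˡ : ∀ x → Z 0ᴹ x
  Z-0ˡ x = trans (ξ-cong (≈ᴹ-sym (*ₗ-zeroˡ 0ᴹ)) ≈ᴹ-refl) (trans (ξ-*ˡ 0# 0ᴹ x) (zeroˡ _))

  ξ-lc2 : ∀ P Q a b x → ξ (lc2 P Q a b) x ≈ a * ξ P x + b * ξ Q x
  ξ-lc2 P Q a b x = trans (ξ-+ˡ _ _ x) (+-cong (ξ-*ˡ a P x) (ξ-*ˡ b Q x))

  Z-cong : ∀ {u v u′ v′} → u ≈ᴹ u′ → v ≈ᴹ v′ → Z u v → Z u′ v′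
  Z-cong e₁ e₂ z = trans (ξ-cong (≈ᴹ-sym e₁) (≈ᴹ-sym e₂)) z

  ¬Z-lc2 : ∀ {P Q x} a b → ¬ a ≈ 0# → ¬ Z P x → Z Q x → ¬ Z (lc2 Q P b a) x
  ¬Z-lc2 {P} {Q} {x} a b a≉0 ¬zP zQ z = ¬zP (cancelˡ (begin
      a * ξ P x                    ≈⟨ sym (+-identityˡ _) ⟩
      0# + a * ξ P x               ≈⟨ +-congʳ (sym (trans (*-congˡ zQ) (zeroʳ b))) ⟩
      b * ξ Q x + a * ξ P x        ≈⟨ sym (ξ-lc2 Q P b a x) ⟩
      ξ (lc2 Q P b a) x            ≈⟨ z ⟩
      0#                           ∎) a≉0)
    where open SetoidReasoning setoid

  -- Points of P.  Projective equality and orthogonality are wrapped in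
  -- records so that Agda can infer the points they relate.

  record _≐ₚ_ (p q : Pt) : Set (r ⊔ ℓm) where
    constructor mk≐
    field get≐ : _≐_ R M p q
  open _≐ₚ_ public

  record _⟂_ (p q : Pt) : Set ℓr where
    constructor mk⟂
    field get⟂ : Z (vc p) (vc q)
  open _⟂_ public

  point-nonzero : ∀ {p : Pt} {P Q a b} → vc p ≈ᴹ lc2 P Q a b → a ≈ 0# → b ≈ 0# → ⊥
  point-nonzero {p} e a≈0 b≈0 = proj₂ p (≈ᴹ-trans e (lc2-zero a≈0 b≈0))

  ≐refl : ∀ {p} → p ≐ₚ p
  ≐refl {p} = mk≐ (1# , ≈ᴹ-sym (*ₗ-identityˡ (vc p)))

  ≐trans : ∀ {p q s} → p ≐ₚ q → q ≐ₚ s → p ≐ₚ s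
  ≐trans {s = s} (mk≐ (a , e₁)) (mk≐ (b , e₂)) =
    mk≐ (a * b , ≈ᴹ-trans e₁ (≈ᴹ-trans (*ₗ-congˡ e₂) (≈ᴹ-sym (*ₗ-assoc a b (vc s)))))

  ≐sym : ∀ {p q} → p ≐ₚ q → q ≐ₚ p
  ≐sym {p} {q} (mk≐ (a , e)) = mk≐ (a⁻¹ , (begin
      vc q                  ≈⟨ ≈ᴹ-sym (*ₗ-identityˡ _) ⟩
      1# *ₗ vc q            ≈⟨ *ₗ-congʳ (sym a⁻¹a) ⟩
      (a⁻¹ * a) *ₗ vc q     ≈⟨ *ₗ-assoc a⁻¹ a _ ⟩
      a⁻¹ *ₗ (a *ₗ vc q)    ≈⟨ *ₗ-congˡ (≈ᴹ-sym e) ⟩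
      a⁻¹ *ₗ vc p           ∎))
    where
    open SetoidReasoning ≈ᴹ-setoid
    a≉0 : ¬ a ≈ 0#
    a≉0 a≈0 = proj₂ p (≈ᴹ-trans e (≈ᴹ-trans (*ₗ-congʳ a≈0) (*ₗ-zeroˡ _)))
    a⁻¹ = proj₁ (inverseˡ a a≉0)
    a⁻¹a = proj₂ (inverseˡ a a≉0)

  ⟂-sym : ∀ {p q} → p ⟂ q → q ⟂ p
  ⟂-sym {p} {q} (mk⟂ z) = mk⟂ (rflx (vc p) (vc q) z)

  ⟂-self : ∀ p → p ⟂ p
  ⟂-self p = mk⟂ (symp p)

  ⟂-resp : ∀ {p p′ q q′} → p′ ≐ₚ p → q′ ≐ₚ q → p ⟂ q → p′ ⟂ q′
  ⟂-resp {p} {q = q} (mk≐ (a , e₁)) (mk≐ (b , e₂)) (mk⟂ z) =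
    mk⟂ (Z-cong (≈ᴹ-sym e₁) (≈ᴹ-sym e₂) (trans (ξ-*ˡ a (vc p) _) (trans (*-congˡ z′) (zeroʳ a))))
    where
    z′ : Z (vc p) (b *ₗ vc q)
    z′ = trans (ξ-*ʳ b (vc p) (vc q)) (trans (*-congʳ z) (zeroˡ _))

  ¬⟂-resp : ∀ {p p′ q q′} → p ≐ₚ p′ → q ≐ₚ q′ → ¬ p ⟂ q → ¬ p′ ⟂ q′
  ¬⟂-resp e₁ e₂ ¬z z = ¬z (⟂-resp e₁ e₂ z)

  ⟂-of-≐ : ∀ {p q} → q ≐ₚ p → p ⟂ q
  ⟂-of-≐ {p} e = ⟂-resp ≐refl e (⟂-self p)

  point-of-¬Z : ∀ (v : V) {x : Pt} → ¬ Z v (vc x) → Pt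
  point-of-¬Z v ¬z = v , λ v≈0 → ¬z (Z-cong (≈ᴹ-sym v≈0) ≈ᴹ-refl (Z-0ˡ _))

  _≑ₘ_ : VP → VP → Set (r ⊔ ℓm)
  P ≑ₘ Q = ((proj₁ P ≐ₚ proj₁ Q) × (proj₂ P ≐ₚ proj₂ Q)) ⊎ ((proj₁ P ≐ₚ proj₂ Q) × (proj₂ P ≐ₚ proj₁ Q))

  ≑-from : ∀ {P Q} → _≑_ R M P Q → P ≑ₘ Q
  ≑-from (inj₁ (a , b)) = inj₁ (mk≐ a , mk≐ b)
  ≑-from (inj₂ (a , b)) = inj₂ (mk≐ a , mk≐ b)

  ≑-to : ∀ {P Q} → P ≑ₘ Q → _≑_ R M P Q
  ≑-to (inj₁ (a , b)) = inj₁ (get≐ a , get≐ b)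
  ≑-to (inj₂ (a , b)) = inj₂ (get≐ a , get≐ b)

  ≑refl : ∀ {P} → P ≑ₘ P
  ≑refl = inj₁ (≐refl , ≐refl)

  ≑sym : ∀ {P Q} → P ≑ₘ Q → Q ≑ₘ P
  ≑sym (inj₁ (e₁ , e₂)) = inj₁ (≐sym e₁ , ≐sym e₂)
  ≑sym (inj₂ (e₁ , e₂)) = inj₂ (≐sym e₂ , ≐sym e₁)

  ≑trans : ∀ {P Q T} → P ≑ₘ Q → Q ≑ₘ T → P ≑ₘ T
  ≑trans (inj₁ (a , b)) (inj₁ (c , d)) = inj₁ (≐trans a c , ≐trans b d)
  ≑trans (inj₁ (a , b)) (inj₂ (c , d)) = inj₂ (≐trans a c , ≐trans b d)
  ≑trans (inj₂ (a , b)) (inj₁ (c , d)) = inj₂ (≐trans a d , ≐trans b c)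
  ≑trans (inj₂ (a , b)) (inj₂ (c , d)) = inj₁ (≐trans a d , ≐trans b c)

  ℋ-intro : ∀ {P x y} → P ≑ₘ (x , y) → y ⟂ x → ℋ P
  ℋ-intro {P} {x} {y} e (mk⟂ z) = x , y , z , ≑-to {P} {x , y} e

  ⟂-of-≑ : ∀ {x y x′ y′} → (x , y) ≑ₘ (x′ , y′) → y′ ⟂ x′ → y ⟂ x
  ⟂-of-≑ (inj₁ (e₁ , e₂)) z = ⟂-resp e₂ e₁ z
  ⟂-of-≑ (inj₂ (e₁ , e₂)) z = ⟂-resp e₂ e₁ (⟂-sym z)

  ℋ-elim : ∀ {P x y} → ℋ P → P ≑ₘ (x , y) → y ⟂ x
  ℋ-elim {P} (x′ , y′ , z , e′) e = ⟂-of-≑ (≑trans (≑sym e) (≑-from {P} {x′ , y′} e′)) (mk⟂ z)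

  ¬ℋ-elim : ∀ {P x y} → ¬ ℋ P → P ≑ₘ (x , y) → ¬ y ⟂ x
  ¬ℋ-elim ¬h e z = ¬h (ℋ-intro e z)

  -- Lines of P.  Incidence is wrapped in a record for inference, as above.

  record _∈ₗ_ (p : Pt) (L : PL) : Set (r ⊔ ℓm) where
    constructor mk∈
    field get∈ : _onP_ R M p L
  open _∈ₗ_ public

  pa pb : PL → V
  pa L = vc (PLine.pa L)
  pb L = vc (PLine.pb L)

  ∈ₗ-resp : ∀ {L p q} → q ≐ₚ p → p ∈ₗ L → q ∈ₗ L
  ∈ₗ-resp (mk≐ (c , e)) (mk∈ (α , β , e′)) =
    mk∈ (c * α , c * β , ≈ᴹ-trans e (≈ᴹ-trans (*ₗ-congˡ e′) (lc2-scale _ _ c α β)))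

  ∈ₗ-combination : ∀ {L u w p} c d → u ∈ₗ L → w ∈ₗ L → vc p ≈ᴹ c *ₗ vc u +ᴹ d *ₗ vc w → p ∈ₗ L
  ∈ₗ-combination c d (mk∈ (a , b , e₁)) (mk∈ (a′ , b′ , e₂)) e =
    mk∈ (c * a + d * a′ , c * b + d * b′ ,
         ≈ᴹ-trans e (≈ᴹ-trans (+ᴹ-cong (*ₗ-congˡ e₁) (*ₗ-congˡ e₂)) (lc2-combine _ _ c d a b a′ b′)))

  coord₁ coord₂ : ∀ {p L} → p ∈ₗ L → Carrier
  coord₁ (mk∈ (a , b , e)) = a
  coord₂ (mk∈ (a , b , e)) = b

  coord-eq : ∀ {p L} (pL : p ∈ₗ L) → vc p ≈ᴹ lc2 (pa L) (pb L) (coord₁ pL) (coord₂ pL)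
  coord-eq (mk∈ (a , b , e)) = e

  ξ-coord : ∀ {p L} (pL : p ∈ₗ L) x → ξ (vc p) x ≈ coord₁ pL * ξ (pa L) x + coord₂ pL * ξ (pb L) x
  ξ-coord pL x = trans (ξ-cong (coord-eq pL) ≈ᴹ-refl) (ξ-lc2 _ _ _ _ x)

  det : Carrier → Carrier → Carrier → Carrier → Carrier
  det u₁ u₂ w₁ w₂ = u₁ * w₂ + - (u₂ * w₁)

  det-on : ∀ {u w L} → u ∈ₗ L → w ∈ₗ L → Carrier
  det-on uL wL = det (coord₁ uL) (coord₂ uL) (coord₁ wL) (coord₂ wL)

  cramer : ∀ {P Q u w v u₁ u₂ w₁ w₂ v₁ v₂} →
           u ≈ᴹ lc2 P Q u₁ u₂ → w ≈ᴹ lc2 P Q w₁ w₂ → v ≈ᴹ lc2 P Q v₁ v₂ →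
           det u₁ u₂ w₁ w₂ *ₗ v ≈ᴹ lc2 u w (det v₁ v₂ w₁ w₂) (det u₁ u₂ v₁ v₂)
  cramer {P} {Q} {u} {w} {v} {u₁} {u₂} {w₁} {w₂} {v₁} {v₂} eu ew ev = begin
    D *ₗ v                                                ≈⟨ *ₗ-congˡ ev ⟩
    D *ₗ lc2 P Q v₁ v₂                                    ≈⟨ lc2-scale P Q D v₁ v₂ ⟩
    lc2 P Q (D * v₁) (D * v₂)                             ≈⟨ lc2-cong (expand₁ u₁ u₂ w₁ w₂ v₁ v₂) (expand₂ u₁ u₂ w₁ w₂ v₁ v₂) ⟩
    lc2 P Q (Dvw * u₁ + Duv * w₁) (Dvw * u₂ + Duv * w₂)   ≈⟨ ≈ᴹ-sym (lc2-combine P Q Dvw Duv u₁ u₂ w₁ w₂) ⟩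
    Dvw *ₗ lc2 P Q u₁ u₂ +ᴹ Duv *ₗ lc2 P Q w₁ w₂          ≈⟨ +ᴹ-cong (*ₗ-congˡ (≈ᴹ-sym eu)) (*ₗ-congˡ (≈ᴹ-sym ew)) ⟩
    lc2 u w Dvw Duv                                       ∎
    where
    open SetoidReasoning ≈ᴹ-setoid
    D = det u₁ u₂ w₁ w₂
    Dvw = det v₁ v₂ w₁ w₂
    Duv = det u₁ u₂ v₁ v₂
    expand₁ : ∀ u₁ u₂ w₁ w₂ v₁ v₂ → det u₁ u₂ w₁ w₂ * v₁ ≈ det v₁ v₂ w₁ w₂ * u₁ + det u₁ u₂ v₁ v₂ * w₁
    expand₁ = solve 6 (λ u₁ u₂ w₁ w₂ v₁ v₂ →
      (u₁ :* w₂ :+ :- (u₂ :* w₁)) :* v₁ := (v₁ :* w₂ :+ :- (v₂ :* w₁)) :* u₁ :+ (u₁ :* v₂ :+ :- (u₂ :* v₁)) :* w₁) refl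
    expand₂ : ∀ u₁ u₂ w₁ w₂ v₁ v₂ → det u₁ u₂ w₁ w₂ * v₂ ≈ det v₁ v₂ w₁ w₂ * u₂ + det u₁ u₂ v₁ v₂ * w₂
    expand₂ = solve 6 (λ u₁ u₂ w₁ w₂ v₁ v₂ →
      (u₁ :* w₂ :+ :- (u₂ :* w₁)) :* v₂ := (v₁ :* w₂ :+ :- (v₂ :* w₁)) :* u₂ :+ (u₁ :* v₂ :+ :- (u₂ :* v₁)) :* w₂) refl

  ≐-of-proportional : ∀ {u w : Pt} {P Q u₁ u₂ w₁ w₂} k → vc u ≈ᴹ lc2 P Q u₁ u₂ → vc w ≈ᴹ lc2 P Q w₁ w₂ →
                      u₁ ≈ k * w₁ → u₂ ≈ k * w₂ → u ≐ₚ w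
  ≐-of-proportional {u} {w} {P} {Q} {u₁} {u₂} {w₁} {w₂} k eu ew e₁ e₂ = mk≐ (k , (begin
      vc u                        ≈⟨ eu ⟩
      lc2 P Q u₁ u₂               ≈⟨ lc2-cong e₁ e₂ ⟩
      lc2 P Q (k * w₁) (k * w₂)   ≈⟨ ≈ᴹ-sym (lc2-scale P Q k w₁ w₂) ⟩
      k *ₗ lc2 P Q w₁ w₂          ≈⟨ *ₗ-congˡ (≈ᴹ-sym ew) ⟩
      k *ₗ vc w                   ∎))
    where open SetoidReasoning ≈ᴹ-setoid

  det-nonzero-distinct : ∀ {u w L} (uL : u ∈ₗ L) (wL : w ∈ₗ L) → ¬ (u ≐ₚ w) → ¬ det-on uL wL ≈ 0#
  det-nonzero-distinct {w = w} uL wL u≠w D≈0 = w₁≉0-absurd w₁≈0-absurd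
    where
    open SetoidReasoning setoid
    u₁ = coord₁ uL ; u₂ = coord₂ uL ; w₁ = coord₁ wL ; w₂ = coord₂ wL
    cross : u₁ * w₂ ≈ u₂ * w₁
    cross = trans (inverseˡ-unique _ _ D≈0) (⁻¹-involutive _)
    -- w₁ ≠ 0: u = (u₁/w₁)·w
    w₁≉0-absurd : ¬ ¬ w₁ ≈ 0#
    w₁≉0-absurd w₁≉0 = u≠w (≐-of-proportional (u₁ * w₁⁻¹) (coord-eq uL) (coord-eq wL)
        (sym (*-inverse-cancel w₁⁻¹w₁)) (begin
        u₂                    ≈⟨ sym (*-inverse-cancel w₁⁻¹w₁) ⟩
        u₂ * w₁⁻¹ * w₁        ≈⟨ solve 3 (λ a b c → a :* b :* c := b :* (a :* c)) refl u₂ w₁⁻¹ w₁ ⟩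
        w₁⁻¹ * (u₂ * w₁)      ≈⟨ *-congˡ (sym cross) ⟩
        w₁⁻¹ * (u₁ * w₂)      ≈⟨ solve 3 (λ a b c → b :* (a :* c) := a :* b :* c) refl u₁ w₁⁻¹ w₂ ⟩
        u₁ * w₁⁻¹ * w₂        ∎))
      where
      w₁⁻¹ = proj₁ (inverseˡ w₁ w₁≉0)
      w₁⁻¹w₁ = proj₂ (inverseˡ w₁ w₁≉0)
    -- w₁ = 0: then w₂ ≠ 0, u₁ = 0 and u = (u₂/w₂)·w
    w₁≈0-absurd : ¬ w₁ ≈ 0#
    w₁≈0-absurd w₁≈0 = w₂≉0-absurd (point-nonzero {w} (coord-eq wL) w₁≈0)
      where
      w₂≉0-absurd : ¬ ¬ w₂ ≈ 0#
      w₂≉0-absurd w₂≉0 = u≠w (≐-of-proportional (u₂ * w₂⁻¹) (coord-eq uL) (coord-eq wL)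
          (trans u₁≈0 (sym (trans (*-congˡ w₁≈0) (zeroʳ _)))) (sym (*-inverse-cancel w₂⁻¹w₂)))
        where
        w₂⁻¹ = proj₁ (inverseˡ w₂ w₂≉0)
        w₂⁻¹w₂ = proj₂ (inverseˡ w₂ w₂≉0)
        u₁≈0 : u₁ ≈ 0#
        u₁≈0 = cancelʳ (trans cross (trans (*-congˡ w₁≈0) (zeroʳ u₂))) w₂≉0

  -- A point orthogonal to f and a point not orthogonal to f have nonzero
  -- determinant: det = 0 would force both coordinates of the first to vanish.
  det-nonzero-separated : ∀ {u w L} (uL : u ∈ₗ L) (wL : w ∈ₗ L) (f : Pt) → u ⟂ f → ¬ w ⟂ f → ¬ det-on uL wL ≈ 0#
  det-nonzero-separated {u} {L = L} uL wL f (mk⟂ zu) w⟂̸f D≈0 = point-nonzero {u} (coord-eq uL) u₁≈0 u₂≈0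
    where
    open SetoidReasoning setoid
    u₁ = coord₁ uL ; u₂ = coord₂ uL ; w₁ = coord₁ wL ; w₂ = coord₂ wL
    a = ξ (pa L) (vc f) ; b = ξ (pb L) (vc f)
    u-sum : u₁ * a + u₂ * b ≈ 0#
    u-sum = trans (sym (ξ-coord uL (vc f))) zu
    w-sum : ¬ (w₁ * a + w₂ * b ≈ 0#)
    w-sum e = w⟂̸f (mk⟂ (trans (ξ-coord wL (vc f)) e))
    u₂≈0 : u₂ ≈ 0#
    u₂≈0 = cancelʳ (begin
      u₂ * (w₁ * a + w₂ * b)                                    ≈⟨ solve 6 (λ u₁ u₂ w₁ w₂ a b →
          u₂ :* (w₁ :* a :+ w₂ :* b) := w₂ :* (u₁ :* a :+ u₂ :* b) :+ :- ((u₁ :* w₂ :+ :- (u₂ :* w₁)) :* a)) refl u₁ u₂ w₁ w₂ a b ⟩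
      w₂ * (u₁ * a + u₂ * b) + - (det u₁ u₂ w₁ w₂ * a)          ≈⟨ +-cong (*-congˡ u-sum) (-‿cong (*-congʳ D≈0)) ⟩
      w₂ * 0# + - (0# * a)                                      ≈⟨ solve 2 (λ x y → x :* con (+ 0) :+ :- (con (+ 0) :* y) := con (+ 0)) refl w₂ a ⟩
      0#                                                        ∎) w-sum
    u₁≈0 : u₁ ≈ 0#
    u₁≈0 = cancelʳ (begin
      u₁ * (w₁ * a + w₂ * b)                                    ≈⟨ solve 6 (λ u₁ u₂ w₁ w₂ a b →
          u₁ :* (w₁ :* a :+ w₂ :* b) := w₁ :* (u₁ :* a :+ u₂ :* b) :+ (u₁ :* w₂ :+ :- (u₂ :* w₁)) :* b) refl u₁ u₂ w₁ w₂ a b ⟩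
      w₁ * (u₁ * a + u₂ * b) + det u₁ u₂ w₁ w₂ * b              ≈⟨ +-cong (*-congˡ u-sum) (*-congʳ D≈0) ⟩
      w₁ * 0# + 0# * b                                          ≈⟨ solve 2 (λ x y → x :* con (+ 0) :+ con (+ 0) :* y := con (+ 0)) refl w₁ b ⟩
      0#                                                        ∎) w-sum

  span : ∀ {u w v L} (uL : u ∈ₗ L) (wL : w ∈ₗ L) → ¬ det-on uL wL ≈ 0# → v ∈ₗ L →
         ∃₂ λ α β → vc v ≈ᴹ lc2 (vc u) (vc w) α β
  span {u} {w} {v} uL wL D≉0 vL = D⁻¹ * Dvw , D⁻¹ * Duv , (begin
      vc v                             ≈⟨ ≈ᴹ-sym (*ₗ-identityˡ _) ⟩
      1# *ₗ vc v                       ≈⟨ *ₗ-congʳ (sym D⁻¹D) ⟩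
      (D⁻¹ * D) *ₗ vc v                ≈⟨ *ₗ-assoc D⁻¹ D _ ⟩
      D⁻¹ *ₗ (D *ₗ vc v)               ≈⟨ *ₗ-congˡ (cramer (coord-eq uL) (coord-eq wL) (coord-eq vL)) ⟩
      D⁻¹ *ₗ lc2 (vc u) (vc w) Dvw Duv ≈⟨ lc2-scale _ _ D⁻¹ Dvw Duv ⟩
      lc2 (vc u) (vc w) (D⁻¹ * Dvw) (D⁻¹ * Duv) ∎)
    where
    open SetoidReasoning ≈ᴹ-setoid
    D = det-on uL wL
    D⁻¹ = proj₁ (inverseˡ D D≉0)
    D⁻¹D = proj₂ (inverseˡ D D≉0)
    Dvw = det (coord₁ vL) (coord₂ vL) (coord₁ wL) (coord₂ wL)
    Duv = det (coord₁ uL) (coord₂ uL) (coord₁ vL) (coord₂ vL)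

  coeff-nonzero : ∀ {h : Pt} {A B x γ δ} → vc h ≈ᴹ lc2 A B γ δ → Z (vc h) x → ¬ Z B x → ¬ γ ≈ 0#
  coeff-nonzero {h} {A} {B} {x} {γ} {δ} eh zh B⟂̸x γ≈0 = point-nonzero {h} eh γ≈0 δ≈0
    where
    open SetoidReasoning setoid
    δ≈0 : δ ≈ 0#
    δ≈0 = cancelʳ (begin
      δ * ξ B x                   ≈⟨ sym (+-identityˡ _) ⟩
      0# + δ * ξ B x              ≈⟨ +-congʳ (sym (trans (*-congʳ γ≈0) (zeroˡ _))) ⟩
      γ * ξ A x + δ * ξ B x       ≈⟨ sym (ξ-lc2 A B γ δ x) ⟩
      ξ (lc2 A B γ δ) x           ≈⟨ Z-cong eh ≈ᴹ-refl zh ⟩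
      0#                          ∎) B⟂̸x

  -- On a line containing a point not orthogonal to f, the points orthogonal
  -- to f coincide (ξ(-,f) is a nonzero functional on a 2-space).
  ⟂-unique : ∀ {u w v f : Pt} {L : PL} → u ∈ₗ L → w ∈ₗ L → u ⟂ f → ¬ w ⟂ f → v ∈ₗ L → v ⟂ f → v ≐ₚ u
  ⟂-unique {u} {w} {v} {f} uL wL u⟂f w⟂̸f vL (mk⟂ zv) = mk≐ (μ , ≈ᴹ-trans ev (lc2-0ʳ _ _ μ ν≈0))
    where
    open SetoidReasoning setoid
    v-span = span uL wL (det-nonzero-separated uL wL f u⟂f w⟂̸f) vL
    μ = proj₁ v-span ; ν = proj₁ (proj₂ v-span)
    ev : vc v ≈ᴹ lc2 (vc u) (vc w) μ ν
    ev = proj₂ (proj₂ v-span)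
    ν≈0 : ν ≈ 0#
    ν≈0 = cancelʳ (begin
        ν * ξ (vc w) (vc f)                          ≈⟨ sym (+-identityˡ _) ⟩
        0# + ν * ξ (vc w) (vc f)                     ≈⟨ +-congʳ (sym (trans (*-congˡ (get⟂ u⟂f)) (zeroʳ μ))) ⟩
        μ * ξ (vc u) (vc f) + ν * ξ (vc w) (vc f)    ≈⟨ sym (ξ-lc2 _ _ μ ν (vc f)) ⟩
        ξ (lc2 (vc u) (vc w) μ ν) (vc f)             ≈⟨ Z-cong ev ≈ᴹ-refl zv ⟩
        0#                                           ∎) (λ e → w⟂̸f (mk⟂ e))

  data _∈ᵥ_ (P : VP) : VLine R M → Set (r ⊔ m ⊔ ℓm) where
    mk∈ᵥ : ∀ {b L} y → y ∈ₗ L → P ≑ₘ (b , y) → P ∈ᵥ (b ⊕ L)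

  ∈ᵥ-from : ∀ {P b L} → _∈V_ R M P (b ⊕ L) → P ∈ᵥ (b ⊕ L)
  ∈ᵥ-from {P} {b} (y , yL , e) = mk∈ᵥ y (mk∈ yL) (≑-from {P} {b , y} e)

  ∈ᵥ-to : ∀ {P b L} → P ∈ᵥ (b ⊕ L) → _∈V_ R M P (b ⊕ L)
  ∈ᵥ-to {P} {b} (mk∈ᵥ y (mk∈ yL) e) = y , yL , ≑-to {P} {b , y} e

  ∈ᵥ-base : ∀ {b L y} → y ∈ₗ L → (b , y) ∈ᵥ (b ⊕ L)
  ∈ᵥ-base yL = mk∈ᵥ _ yL ≑refl

  -- Every point 2y lies in ℋ (κ is symplectic), so the lines 2L are not
  -- lines of 𝔄.
  double⊆ℋ : ∀ {L} → ¬ (∃ λ P → (_∈V_ R M P (double L)) × ¬ ℋ P)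
  double⊆ℋ (P , (y , yL , e) , ¬h) = ¬h (ℋ-intro (≑-from {P} {y , y} e) (⟂-self y))

  -- Either b = c and M, N share a point t with ξ(t,b) ≠ 0 (common point b + t),
  -- or b ∈ N, c ∈ M and ξ(b,c) ≠ 0 (common point b + c).
  SharedBase : Pt → PL → Pt → PL → Set (r ⊔ m ⊔ ℓm ⊔ ℓr)
  SharedBase b M c N = b ≐ₚ c × ∃ λ t → t ∈ₗ M × t ∈ₗ N × ¬ t ⟂ b

  SwappedBase : Pt → PL → Pt → PL → Set (r ⊔ ℓm ⊔ ℓr)
  SwappedBase b M c N = b ∈ₗ N × c ∈ₗ M × ¬ b ⟂ c

  Crossing : Pt → PL → Pt → PL → Set (r ⊔ m ⊔ ℓm ⊔ ℓr)
  Crossing b M c N = SharedBase b M c N ⊎ SwappedBase b M c N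

  crossing-of-common-point : ∀ {b M c N} (P : VP) → ¬ ℋ P → P ∈ᵥ (b ⊕ M) → P ∈ᵥ (c ⊕ N) → Crossing b M c N
  crossing-of-common-point P ¬h (mk∈ᵥ y yM e₁) (mk∈ᵥ y′ yN e₂) with ≑trans (≑sym e₁) e₂
  ... | inj₁ (b≐c , y≐y′) = inj₁ (b≐c , y , yM , ∈ₗ-resp y≐y′ yN , ¬ℋ-elim ¬h e₁)
  ... | inj₂ (b≐y′ , y≐c) = inj₂ (∈ₗ-resp b≐y′ yN , ∈ₗ-resp (≐sym y≐c) yM , λ z → ¬h (ℋ-intro e₁ (⟂-resp y≐c ≐refl (⟂-sym z))))

  crossing-of-meet : ∀ {b M c N wM wN} → Meet ((b ⊕ M) , wM) ((c ⊕ N) , wN) → Crossing b M c N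
  crossing-of-meet {b} {M} {c} {N} ((P , ¬h) , P∈M , P∈N) =
    crossing-of-common-point P ¬h (∈ᵥ-from {P} {b} {M} P∈M) (∈ᵥ-from {P} {c} {N} P∈N)

  meet-of-crossing : ∀ {b M c N wM wN} → Crossing b M c N → Meet ((b ⊕ M) , wM) ((c ⊕ N) , wN)
  meet-of-crossing {b} {M} {c} {N} (inj₁ (b≐c , t , tM , tN , t⟂̸b)) =
    ((b , t) , (λ h → t⟂̸b (ℋ-elim {b , t} h ≑refl))) ,
    ∈ᵥ-to {b , t} {b} {M} (∈ᵥ-base tM) , ∈ᵥ-to {b , t} {c} {N} (mk∈ᵥ t tN (inj₁ (b≐c , ≐refl)))
  meet-of-crossing {b} {M} {c} {N} (inj₂ (bN , cM , b⟂̸c)) =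
    ((b , c) , (λ h → b⟂̸c (⟂-sym (ℋ-elim {b , c} h ≑refl)))) ,
    ∈ᵥ-to {b , c} {b} {M} (∈ᵥ-base cM) , ∈ᵥ-to {b , c} {c} {N} (mk∈ᵥ b bN (inj₂ (≐refl , ≐refl)))

  crossing-sym : ∀ {b M c N} → Crossing b M c N → Crossing c N b M
  crossing-sym (inj₁ (b≐c , t , tM , tN , t⟂̸b)) = inj₁ (≐sym b≐c , t , tN , tM , ¬⟂-resp ≐refl b≐c t⟂̸b)
  crossing-sym (inj₂ (bN , cM , b⟂̸c)) = inj₂ (cM , bN , λ z → b⟂̸c (⟂-sym z))

  ≠-of-¬⟂ : ∀ {p q} → ¬ p ⟂ q → ¬ q ≐ₚ p
  ≠-of-¬⟂ p⟂̸q q≐p = p⟂̸q (⟂-of-≐ q≐p)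

  crossing-of-⟂-bases : ∀ {b M c N} → b ⟂ c → Crossing b M c N → SharedBase b M c N
  crossing-of-⟂-bases b⟂c (inj₁ shared)             = shared
  crossing-of-⟂-bases b⟂c (inj₂ (_ , _ , b⟂̸c)) = ⊥-elim (b⟂̸c b⟂c)

  crossing-of-distinct-bases : ∀ {b M c N} → ¬ b ≐ₚ c → Crossing b M c N → SwappedBase b M c N
  crossing-of-distinct-bases b≠c (inj₁ (b≐c , _)) = ⊥-elim (b≠c b≐c)
  crossing-of-distinct-bases b≠c (inj₂ swapped)    = swapped

  -- A line b ⊕ L of 𝔄 has a point y ∈ L with ξ(y,b) ≠ 0;
  -- then h(b,L) = ξ(B,b)A − ξ(A,b)B, for L = ⟨A,B⟩, is the unique point of L
  -- orthogonal to b, and b + h(b,L) is the unique point of ℋ on b ⊕ L.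

  Transversal : Pt → PL → Set (r ⊔ m ⊔ ℓm ⊔ ℓr)
  Transversal b L = Σ Pt λ y → y ∈ₗ L × ¬ y ⟂ b

  -- the condition for b ⊕ L to be a line of 𝔄
  Off-ℋ : Pt → PL → Set (r ⊔ m ⊔ ℓm ⊔ ℓr)
  Off-ℋ b L = ∃ λ P → (_∈V_ R M P (b ⊕ L)) × ¬ ℋ P

  transversal : ∀ {b L} → Off-ℋ b L → Transversal b L
  transversal {b} {L} (P , P∈ , ¬h) with ∈ᵥ-from {P} {b} {L} P∈
  ... | mk∈ᵥ y yL e = y , yL , ¬ℋ-elim ¬h e

  polar-vector : Pt → PL → V
  polar-vector b L = lc2 (pa L) (pb L) (ξ (pb L) (vc b)) (- ξ (pa L) (vc b))

  polar-nonzero : ∀ b L → Transversal b L → ¬ polar-vector b L ≈ᴹ 0ᴹ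
  polar-nonzero b L (y , yL , y⟂̸b) h≈0 = c≉0-absurd (λ c≈0 → a≉0-absurd (λ a≈0 → y⟂̸b (mk⟂ (y⟂b c≈0 a≈0))))
    where
    A = pa L ; B = pb L ; a = ξ A (vc b) ; c = ξ B (vc b)
    -- c ≠ 0 makes A a multiple of B
    c≉0-absurd : ¬ ¬ c ≈ 0#
    c≉0-absurd c≉0 = PLine.independent L (solve-for-first h≈0 c≉0)
    -- a ≠ 0 makes B a multiple of A
    a≉0-absurd : ¬ ¬ a ≈ 0#
    a≉0-absurd a≉0 = PLine.independent L (get≐ (≐sym {PLine.pb L} {PLine.pa L} (mk≐ (solve-for-first (≈ᴹ-trans (lc2-swap B A _ _) h≈0) (-‿nonzero a≉0)))))
    -- a = c = 0 makes every point of L orthogonal to b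
    y⟂b : c ≈ 0# → a ≈ 0# → Z (vc y) (vc b)
    y⟂b c≈0 a≈0 = trans (ξ-coord yL (vc b)) (trans (+-cong (*-congˡ a≈0) (*-congˡ c≈0))
                    (solve 2 (λ x z → x :* con (+ 0) :+ z :* con (+ 0) := con (+ 0)) refl _ _))

  polar-point : ∀ b L → Transversal b L → Pt
  polar-point b L t = polar-vector b L , polar-nonzero b L t

  polar-∈ : ∀ b L t → polar-point b L t ∈ₗ L
  polar-∈ b L t = mk∈ (_ , _ , ≈ᴹ-refl)

  polar-⟂ : ∀ b L t → polar-point b L t ⟂ b
  polar-⟂ b L t = mk⟂ (trans (ξ-lc2 _ _ _ _ (vc b)) (solve 2 (λ c a → c :* a :+ (:- a) :* c := con (+ 0)) refl _ _))

  polar-unique : ∀ b L (t : Transversal b L) {y} → y ∈ₗ L → y ⟂ b → y ≐ₚ polar-point b L t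
  polar-unique b L t@(_ , yL , y⟂̸b) y∈ y⟂b = ⟂-unique (polar-∈ b L t) yL (polar-⟂ b L t) y⟂̸b y∈ y⟂b

  polar-sum : ∀ b L → Transversal b L → VP
  polar-sum b L t = b , polar-point b L t

  polar-sum-∈ : ∀ b L t → polar-sum b L t ∈ᵥ (b ⊕ L)
  polar-sum-∈ b L t = ∈ᵥ-base (polar-∈ b L t)

  polar-sum-ℋ : ∀ b L t → ℋ (polar-sum b L t)
  polar-sum-ℋ b L t = ℋ-intro ≑refl (polar-⟂ b L t)

  polar-sum-unique : ∀ b L (t : Transversal b L) {P} → ℋ P → P ∈ᵥ (b ⊕ L) → P ≑ₘ polar-sum b L t
  polar-sum-unique b L t {P} hP (mk∈ᵥ y yL e) = ≑trans e (inj₁ (≐refl , polar-unique b L t yL (ℋ-elim {P} hP e)))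

  parallel-of-polar-sum : ∀ {b₁ L₁ b₂ L₂} (w₁ : Off-ℋ b₁ L₁) (w₂ : Off-ℋ b₂ L₂) →
        polar-sum b₁ L₁ (transversal w₁) ≑ₘ polar-sum b₂ L₂ (transversal w₂) →
        ((b₁ ⊕ L₁) , w₁) ∥ ((b₂ ⊕ L₂) , w₂)
  parallel-of-polar-sum {b₁} {L₁} {b₂} {L₂} w₁ w₂ E P hP = transfer {b₁} {L₁} {b₂} {L₂} w₁ w₂ E , transfer {b₂} {L₂} {b₁} {L₁} w₂ w₁ (≑sym E)
    where
    transfer : ∀ {b L c N} (w : Off-ℋ b L) (w′ : Off-ℋ c N) →
               polar-sum b L (transversal w) ≑ₘ polar-sum c N (transversal w′) →
               _∈V_ R M P (b ⊕ L) → _∈V_ R M P (c ⊕ N)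
    transfer {b} {L} {c} {N} w w′ E′ P∈ =
      ∈ᵥ-to {P} {c} {N} (mk∈ᵥ _ (polar-∈ c N (transversal w′))
        (≑trans (polar-sum-unique b L (transversal w) hP (∈ᵥ-from {P} {b} {L} P∈)) E′))


  ∈ₗ-of-two-points : ∀ {u w v L K} (uL : u ∈ₗ L) (wL : w ∈ₗ L) → ¬ det-on uL wL ≈ 0# →
                     u ∈ₗ K → w ∈ₗ K → v ∈ₗ L → v ∈ₗ K
  ∈ₗ-of-two-points uL wL D≉0 uK wK vL with span uL wL D≉0 vL
  ... | α , β , e = ∈ₗ-combination α β uK wK e

  -- Two lines of a plane meet.  K contains h and u, N contains B and C, and
  -- (a multiple of) h lies on AB while u lies on AC; then αεh − γu lies on BC,
  -- hence on N.
  plane-meet : ∀ {A B C h u x : Pt} {K N : PL} ε γ δ α β →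
    ε *ₗ vc h ≈ᴹ lc2 (vc A) (vc B) γ δ → vc u ≈ᴹ lc2 (vc A) (vc C) α β → ¬ γ ≈ 0# →
    h ⟂ x → ¬ u ⟂ x → h ∈ₗ K → u ∈ₗ K → B ∈ₗ N → C ∈ₗ N →
    Σ Pt λ v → v ∈ₗ K × v ∈ₗ N × ¬ v ⟂ x
  plane-meet {A} {B} {C} {h} {u} {x} ε γ δ α β eh eu γ≉0 h⟂x u⟂̸x hK uK BN CN =
    v , ∈ₗ-combination (α * ε) (- γ) hK uK ≈ᴹ-refl , ∈ₗ-combination (α * δ) (- γ * β) BN CN v-on-BC , v⟂̸x
    where
    open SetoidReasoning ≈ᴹ-setoid
    v-vec : V
    v-vec = lc2 (vc h) (vc u) (α * ε) (- γ)
    v-vec⟂̸x : ¬ Z v-vec (vc x)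
    v-vec⟂̸x = ¬Z-lc2 (- γ) (α * ε) (-‿nonzero γ≉0) (λ z → u⟂̸x (mk⟂ z)) (get⟂ h⟂x)
    v : Pt
    v = point-of-¬Z v-vec {x} v-vec⟂̸x
    v-on-BC : v-vec ≈ᴹ (α * δ) *ₗ vc B +ᴹ (- γ * β) *ₗ vc C
    v-on-BC = begin
      (α * ε) *ₗ vc h +ᴹ (- γ) *ₗ vc u                        ≈⟨ +ᴹ-cong (≈ᴹ-trans (*ₗ-assoc α ε _) (*ₗ-congˡ eh)) (*ₗ-congˡ eu) ⟩
      α *ₗ lc2 (vc A) (vc B) γ δ +ᴹ (- γ) *ₗ lc2 (vc A) (vc C) α β ≈⟨ eliminate (vc A) (vc B) (vc C) γ δ α β ⟩
      lc2 (vc B) (vc C) (α * δ) (- γ * β)                     ∎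
    v⟂̸x : ¬ v ⟂ x
    v⟂̸x (mk⟂ z) = v-vec⟂̸x z

  -- Comparing the two representatives of each vertex, either all sides have
  -- the same base (a "star": xA = xB = xC) or the vertices are the pairwise
  -- sums of xA, xB, xC (a "triangle"); the mixed cases are impossible.
  module Triangle
    (a b c : APoint) {xA xB xC : Pt} {LA LB LC : PL}
    (wB : Off-ℋ xB LB) (wC : Off-ℋ xC LC)
    {ybA ycA yaB ycB yaC ybC : Pt}
    (ybA∈ : ybA ∈ₗ LA) (ycA∈ : ycA ∈ₗ LA) (yaB∈ : yaB ∈ₗ LB) (ycB∈ : ycB ∈ₗ LB) (yaC∈ : yaC ∈ₗ LC) (ybC∈ : ybC ∈ₗ LC)
    (b≑A : proj₁ b ≑ₘ (xA , ybA)) (c≑A : proj₁ c ≑ₘ (xA , ycA)) (a≑B : proj₁ a ≑ₘ (xB , yaB))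
    (c≑B : proj₁ c ≑ₘ (xB , ycB)) (a≑C : proj₁ a ≑ₘ (xC , yaC)) (b≑C : proj₁ b ≑ₘ (xC , ybC))
    (ncol : ¬ Collinear3 a b c)
    {xK : Pt} {LK : PL} (wK : Off-ℋ xK LK) (K∥C : ((xK ⊕ LK) , wK) ∥ ((xC ⊕ LC) , wC)) where

    not-on-one-side : ∀ {x L} (w : Off-ℋ x L) {ya yb yc} → ya ∈ₗ L → yb ∈ₗ L → yc ∈ₗ L →
                      proj₁ a ≑ₘ (x , ya) → proj₁ b ≑ₘ (x , yb) → proj₁ c ≑ₘ (x , yc) → ⊥
    not-on-one-side {x} {L} w yaL ybL ycL ea eb ec =
      ncol (((x ⊕ L) , w) , ∈ᵥ-to {proj₁ a} {x} {L} (mk∈ᵥ _ yaL ea) ,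
            ∈ᵥ-to {proj₁ b} {x} {L} (mk∈ᵥ _ ybL eb) , ∈ᵥ-to {proj₁ c} {x} {L} (mk∈ᵥ _ ycL ec))

    c-not-on-C : ∀ {y} → y ∈ₗ LC → proj₁ c ≑ₘ (xC , y) → ⊥
    c-not-on-C y∈ = not-on-one-side wC yaC∈ ybC∈ y∈ a≑C b≑C

    yaC≠ybC : ¬ yaC ≐ₚ ybC
    yaC≠ybC e = not-on-one-side wB yaB∈ yaB∈ ycB∈ a≑B
      (≑trans b≑C (≑trans (inj₁ (≐refl , ≐sym e)) (≑trans (≑sym a≑C) a≑B))) c≑B

    yaB≠ycB : ¬ yaB ≐ₚ ycB
    yaB≠ycB e = c-not-on-C yaC∈ (≑trans c≑B (≑trans (inj₁ (≐refl , ≐sym e)) (≑trans (≑sym a≑B) a≑C)))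

    yaC⟂̸xC : ¬ yaC ⟂ xC
    yaC⟂̸xC = ¬ℋ-elim (proj₂ a) a≑C

    ybC⟂̸xC : ¬ ybC ⟂ xC
    ybC⟂̸xC = ¬ℋ-elim (proj₂ b) b≑C

    hC : Pt
    hC = polar-point xC LC (transversal wC)

    hC∈ : hC ∈ₗ LC
    hC∈ = polar-∈ xC LC (transversal wC)

    hC⟂ : hC ⟂ xC
    hC⟂ = polar-⟂ xC LC (transversal wC)

    K-through-polar : (xC , hC) ∈ᵥ (xK ⊕ LK)
    K-through-polar = ∈ᵥ-from {xC , hC} {xK} {LK}
      (proj₂ (K∥C (xC , hC) (polar-sum-ℋ xC LC (transversal wC))) (∈ᵥ-to {xC , hC} {xC} {LC} (polar-sum-∈ xC LC (transversal wC))))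

    -- Star: K = xC ⊕ LK with hC ∈ LK.  LK meets LB in a point u, and LA, LB,
    -- LC lie in the plane ⟨yaC, ybC, ycB⟩, so LK meets LA as well.
    star-core : xA ≐ₚ xC → yaB ≐ₚ yaC → ybA ≐ₚ ybC → ycA ≐ₚ ycB → xK ≐ₚ xC → hC ∈ₗ LK →
                Crossing xK LK xB LB → (xB ≐ₚ xC) → Crossing xK LK xA LA
    star-core _ _ _ _ xK≐xC _ (inj₂ (_ , _ , xK⟂̸xB)) xB≐xC =
      ⊥-elim (xK⟂̸xB (⟂-resp xK≐xC xB≐xC (⟂-self xC)))
    star-core xA≐xC yaB≐yaC ybA≐ybC ycA≐ycB xK≐xC hK (inj₁ (_ , u , uK , uB , u⟂̸xK)) xB≐xC =
      inj₁ (≐trans xK≐xC (≐sym xA≐xC) , v , vK , vA , ¬⟂-resp ≐refl (≐sym xK≐xC) v⟂̸xC)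
      where
      h-span = span yaC∈ ybC∈ (det-nonzero-distinct yaC∈ ybC∈ yaC≠ybC) hC∈
      yaC∈B : yaC ∈ₗ LB
      yaC∈B = ∈ₗ-resp (≐sym yaB≐yaC) yaB∈
      u-span = span yaC∈B ycB∈ (det-nonzero-distinct yaC∈B ycB∈ (λ e → yaB≠ycB (≐trans yaB≐yaC e))) uB
      γ = proj₁ h-span ; δ = proj₁ (proj₂ h-span) ; eh = proj₂ (proj₂ h-span)
      γ≉0 : ¬ γ ≈ 0#
      γ≉0 = coeff-nonzero {hC} eh (get⟂ hC⟂) (λ z → ybC⟂̸xC (mk⟂ z))
      meet : Σ Pt λ v → v ∈ₗ LK × v ∈ₗ LA × ¬ v ⟂ xC
      meet = plane-meet {yaC} {ybC} {ycB} {hC} {u} 1# γ δ (proj₁ u-span) (proj₁ (proj₂ u-span)) (≈ᴹ-trans (*ₗ-identityˡ _) eh) (proj₂ (proj₂ u-span))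
               γ≉0 hC⟂ (¬⟂-resp ≐refl xK≐xC u⟂̸xK) hK uK (∈ₗ-resp (≐sym ybA≐ybC) ybA∈) (∈ₗ-resp (≐sym ycA≐ycB) ycA∈)
      v = proj₁ meet ; vK = proj₁ (proj₂ meet) ; vA = proj₁ (proj₂ (proj₂ meet)) ; v⟂̸xC = proj₂ (proj₂ (proj₂ meet))


    star : xB ≐ₚ xC → xA ≐ₚ xC → yaB ≐ₚ yaC → ybA ≐ₚ ybC → ycA ≐ₚ ycB →
           Crossing xK LK xB LB → Crossing xK LK xA LA
    star xB≐xC xA≐xC yaB≐yaC ybA≐ybC ycA≐ycB = via-polar K-through-polar
      where
      core : xK ≐ₚ xC → hC ∈ₗ LK → Crossing xK LK xB LB → Crossing xK LK xA LA
      core xK≐xC hK KB = star-core xA≐xC yaB≐yaC ybA≐ybC ycA≐ycB xK≐xC hK KB xB≐xC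
      -- xC + hC ∈ K either with base xC (then hC ∈ LK), or with base hC,
      -- in which case hC = xK = xB = xC since K crosses B
      via-polar : (xC , hC) ∈ᵥ (xK ⊕ LK) → Crossing xK LK xB LB → Crossing xK LK xA LA
      via-polar (mk∈ᵥ _ kK (inj₁ (xC≐xK , hC≐k))) KB = core (≐sym xC≐xK) (∈ₗ-resp hC≐k kK) KB
      via-polar (mk∈ᵥ _ kK (inj₂ (xC≐k , hC≐xK))) KB@(inj₁ (xK≐xB , _)) =
        core xK≐xC (∈ₗ-resp (≐trans hC≐xK xK≐xC) (∈ₗ-resp xC≐k kK)) KB
        where
        xK≐xC : xK ≐ₚ xC
        xK≐xC = ≐trans xK≐xB xB≐xC
      via-polar (mk∈ᵥ _ _ (inj₂ (_ , hC≐xK))) (inj₂ (_ , _ , xK⟂̸xB)) =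
        ⊥-elim (xK⟂̸xB (⟂-resp (≐sym hC≐xK) xB≐xC hC⟂))

    -- Triangle: a = xB + xC, b = xA + xC, c = xA + xB.  If K = xC ⊕ LK passes
    -- through hC and yaC = xB, it contains LC, hence ybC = xA, and so K
    -- crosses A = xA ⊕ LA ∋ xC.
    triangle-core : xC ∈ₗ LA → xA ≐ₚ ybC → xK ≐ₚ xC → hC ∈ₗ LK → yaC ∈ₗ LK → Crossing xK LK xA LA
    triangle-core xC∈A xA≐ybC xK≐xC hK yaK =
      inj₂ (∈ₗ-resp xK≐xC xC∈A , ∈ₗ-resp xA≐ybC ybK , ¬⟂-resp (≐sym xK≐xC) (≐sym xA≐ybC) (λ z → ybC⟂̸xC (⟂-sym z)))
      where
      ybK : ybC ∈ₗ LK
      ybK = ∈ₗ-of-two-points hC∈ yaC∈ (det-nonzero-separated hC∈ yaC∈ xC hC⟂ yaC⟂̸xC) hK yaK ybC∈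

    triangle : xB ≐ₚ yaC → yaB ≐ₚ xC → xA ≐ₚ ybC → ybA ≐ₚ xC → xA ≐ₚ ycB →
               Crossing xK LK xB LB → Crossing xK LK xA LA
    triangle xB≐yaC yaB≐xC xA≐ybC ybA≐xC xA≐ycB = via-polar K-through-polar
      where
      core : xK ≐ₚ xC → hC ∈ₗ LK → yaC ∈ₗ LK → Crossing xK LK xA LA
      core = triangle-core (∈ₗ-resp (≐sym ybA≐xC) ybA∈) xA≐ybC
      -- K cannot have base xB = yaC (a would lie in ℋ), so it contains xB;
      -- and hC = xC if hC is the base of K
      via-polar : (xC , hC) ∈ᵥ (xK ⊕ LK) → Crossing xK LK xB LB → Crossing xK LK xA LA
      via-polar (mk∈ᵥ _ _ (inj₁ (xC≐xK , _))) (inj₁ (xK≐xB , _)) =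
        ⊥-elim (yaC⟂̸xC (⟂-of-≐ (≐trans xC≐xK (≐trans xK≐xB xB≐yaC))))
      via-polar (mk∈ᵥ _ kK (inj₁ (xC≐xK , hC≐k))) (inj₂ (_ , xB∈K , _)) =
        core (≐sym xC≐xK) (∈ₗ-resp hC≐k kK) (∈ₗ-resp (≐sym xB≐yaC) xB∈K)
      via-polar (mk∈ᵥ _ _ (inj₂ (_ , hC≐xK))) (inj₁ (xK≐xB , _)) =
        ⊥-elim (yaC⟂̸xC (⟂-resp (≐sym (≐trans hC≐xK (≐trans xK≐xB xB≐yaC))) ≐refl hC⟂))
      via-polar (mk∈ᵥ _ kK (inj₂ (xC≐k , hC≐xK))) (inj₂ (xK∈B , xB∈K , _)) =
        core (≐trans (≐sym hC≐xK) hC≐xC) (∈ₗ-resp hC≐xC (∈ₗ-resp xC≐k kK)) (∈ₗ-resp (≐sym xB≐yaC) xB∈K)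
        where
        -- hC and xC are both points of LB orthogonal to xC
        hC≐xC : hC ≐ₚ xC
        hC≐xC = ⟂-unique (∈ₗ-resp (≐sym yaB≐xC) yaB∈) (∈ₗ-resp (≐trans (≐sym xA≐ybC) xA≐ycB) ycB∈)
                  (⟂-self xC) ybC⟂̸xC (∈ₗ-resp hC≐xK xK∈B) hC⟂

    crossing-KA : Crossing xK LK xB LB → Crossing xK LK xA LA
    crossing-KA = by-shape (≑trans (≑sym a≑B) a≑C) (≑trans (≑sym b≑A) b≑C) (≑trans (≑sym c≑A) c≑B)
      where
      by-shape : (xB , yaB) ≑ₘ (xC , yaC) → (xA , ybA) ≑ₘ (xC , ybC) → (xA , ycA) ≑ₘ (xB , ycB) →
                 Crossing xK LK xB LB → Crossing xK LK xA LA
      by-shape (inj₁ (xB≐xC , yaB≐yaC)) (inj₁ (xA≐xC , ybA≐ybC)) (inj₁ (_ , ycA≐ycB)) =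
        star xB≐xC xA≐xC yaB≐yaC ybA≐ybC ycA≐ycB
      by-shape (inj₂ (xB≐yaC , yaB≐xC)) (inj₂ (xA≐ybC , ybA≐xC)) (inj₂ (xA≐ycB , _)) =
        triangle xB≐yaC yaB≐xC xA≐ybC ybA≐xC xA≐ycB
      by-shape (inj₁ (xB≐xC , _)) (inj₁ (xA≐xC , _)) (inj₂ (_ , ycA≐xB)) _ =
        ⊥-elim (proj₂ c (ℋ-intro c≑A (⟂-of-≐ (≐trans xA≐xC (≐sym (≐trans ycA≐xB xB≐xC))))))
      by-shape (inj₁ (xB≐xC , _)) (inj₂ (xA≐ybC , _)) (inj₁ (xA≐xB , _)) _ =
        ⊥-elim (ybC⟂̸xC (⟂-of-≐ (≐trans (≐sym xB≐xC) (≐trans (≐sym xA≐xB) xA≐ybC))))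
      by-shape (inj₁ (xB≐xC , _)) (inj₂ (xA≐ybC , _)) (inj₂ (_ , ycA≐xB)) _ =
        ⊥-elim (c-not-on-C ybC∈ (≑trans c≑A (inj₂ (xA≐ybC , ≐trans ycA≐xB xB≐xC))))
      by-shape (inj₂ (xB≐yaC , _)) (inj₁ (xA≐xC , _)) (inj₁ (xA≐xB , _)) _ =
        ⊥-elim (yaC⟂̸xC (⟂-of-≐ (≐trans (≐sym xA≐xC) (≐trans xA≐xB xB≐yaC))))
      by-shape (inj₂ (xB≐yaC , _)) (inj₁ (xA≐xC , _)) (inj₂ (_ , ycA≐xB)) _ =
        ⊥-elim (c-not-on-C yaC∈ (≑trans c≑A (inj₁ (xA≐xC , ≐trans ycA≐xB xB≐yaC))))
      by-shape (inj₂ (xB≐yaC , _)) (inj₂ (xA≐ybC , _)) (inj₁ (xA≐xB , _)) _ =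
        ⊥-elim (yaC≠ybC (≐trans (≐sym xB≐yaC) (≐trans (≐sym xA≐xB) xA≐ybC)))


  tamaschke : TamaschkeBedingung
  tamaschke _ _ _ (double L , w) _ _ _ _ _ _ _ _ _ _ _ _ = ⊥-elim (double⊆ℋ {L} w)
  tamaschke _ _ _ _ (double L , w) _ _ _ _ _ _ _ _ _ _ _ = ⊥-elim (double⊆ℋ {L} w)
  tamaschke _ _ _ _ _ (double L , w) _ _ _ _ _ _ _ _ _ _ = ⊥-elim (double⊆ℋ {L} w)
  tamaschke _ _ _ _ _ _ _ _ _ _ _ _ _ (double L , w) _ _ = ⊥-elim (double⊆ℋ {L} w)
  tamaschke a b c ((xA ⊕ LA) , wA) ((xB ⊕ LB) , wB) ((xC ⊕ LC) , wC) bA cA aB cB aC bC ncol ((xK ⊕ LK) , wK) K∥C KB =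
    meet-of-crossing {xK} {LK} {xA} {LA} {wK} {wA}
      (with-representatives (∈ᵥ-from {proj₁ b} {xA} {LA} bA) (∈ᵥ-from {proj₁ c} {xA} {LA} cA)
        (∈ᵥ-from {proj₁ a} {xB} {LB} aB) (∈ᵥ-from {proj₁ c} {xB} {LB} cB)
        (∈ᵥ-from {proj₁ a} {xC} {LC} aC) (∈ᵥ-from {proj₁ b} {xC} {LC} bC)
        (crossing-of-meet {xK} {LK} {xB} {LB} {wK} {wB} KB))
    where
    with-representatives : proj₁ b ∈ᵥ (xA ⊕ LA) → proj₁ c ∈ᵥ (xA ⊕ LA) → proj₁ a ∈ᵥ (xB ⊕ LB) →
                           proj₁ c ∈ᵥ (xB ⊕ LB) → proj₁ a ∈ᵥ (xC ⊕ LC) → proj₁ b ∈ᵥ (xC ⊕ LC) →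
                           Crossing xK LK xB LB → Crossing xK LK xA LA
    with-representatives (mk∈ᵥ _ ybA∈ b≑A) (mk∈ᵥ _ ycA∈ c≑A) (mk∈ᵥ _ yaB∈ a≑B)
                         (mk∈ᵥ _ ycB∈ c≑B) (mk∈ᵥ _ yaC∈ a≑C) (mk∈ᵥ _ ybC∈ b≑C) =
      Triangle.crossing-KA a b c wB wC ybA∈ ycA∈ yaB∈ ycB∈ yaC∈ ybC∈ b≑A c≑A a≑B c≑B a≑C b≑C ncol wK K∥C

  -- All bases equal x; M₁, M₂ share h ⟂ x and N₁, N₂ share k ⟂ x.  Then all
  -- four lines lie in one plane, and M₂ meets N₂ in a point ⟂̸ x: writing
  -- det·h = α′ t₁₁ + β′ t₁₂ (Cramer) and t₂₁ ∈ ⟨k, t₁₁⟩, apply plane-meet.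
  plane-crossing : ∀ {x z b₂ c₂ h k : Pt} {M₁ M₂ N₁ N₂ : PL} →
    h ∈ₗ M₁ → h ∈ₗ M₂ → h ⟂ x → k ∈ₗ N₁ → k ∈ₗ N₂ → k ⟂ x → b₂ ≐ₚ x →
    SharedBase x M₁ z N₁ → SharedBase x M₁ c₂ N₂ → SharedBase b₂ M₂ z N₁ → SharedBase b₂ M₂ c₂ N₂
  plane-crossing {x} {h = h} {k = k} {M₂ = M₂} {N₂ = N₂} hM₁ hM₂ h⟂x kN₁ kN₂ k⟂x b₂≐x
    (_ , t₁₁ , t₁₁M₁ , t₁₁N₁ , t₁₁⟂̸x) (x≐c₂ , t₁₂ , t₁₂M₁ , t₁₂N₂ , t₁₂⟂̸x) (_ , t₂₁ , t₂₁M₂ , t₂₁N₁ , t₂₁⟂̸b₂) =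
    ≐trans b₂≐x x≐c₂ , proj₁ meet , proj₁ (proj₂ meet) , proj₁ (proj₂ (proj₂ meet)) ,
    ¬⟂-resp ≐refl (≐sym b₂≐x) (proj₂ (proj₂ (proj₂ meet)))
    where
    t₂₁-span = span kN₁ t₁₁N₁ (det-nonzero-separated kN₁ t₁₁N₁ x k⟂x t₁₁⟂̸x) t₂₁N₁
    γ = proj₁ t₂₁-span ; δ = proj₁ (proj₂ t₂₁-span)
    α′ = det-on hM₁ t₁₂M₁
    meet : Σ Pt λ t → t ∈ₗ M₂ × t ∈ₗ N₂ × ¬ t ⟂ x
    meet = plane-meet {t₁₁} {t₁₂} {k} {h} {t₂₁} (det-on t₁₁M₁ t₁₂M₁) α′ (det-on t₁₁M₁ hM₁) δ γ
             (cramer (coord-eq t₁₁M₁) (coord-eq t₁₂M₁) (coord-eq hM₁))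
             (≈ᴹ-trans (proj₂ (proj₂ t₂₁-span)) (lc2-swap (vc k) (vc t₁₁) γ δ))
             (det-nonzero-separated hM₁ t₁₂M₁ x h⟂x t₁₂⟂̸x) h⟂x (¬⟂-resp ≐refl b₂≐x t₂₁⟂̸b₂)
             hM₂ t₂₁M₂ t₁₂N₂ kN₂

  -- By L₁ ∥ L₂ and K₁ ∥ K₂ the polar sums x + h of L₁ and z + k of K₁ lie on
  -- L₂ and K₂; the cases below are how they are represented there.
  module Parallelogram {x z : Pt} {M₁ N₁ : PL} (wL₁ : Off-ℋ x M₁) (wK₁ : Off-ℋ z N₁) where

    h : Pt
    h = polar-point x M₁ (transversal wL₁)

    h∈ : h ∈ₗ M₁
    h∈ = polar-∈ x M₁ (transversal wL₁)

    h⟂ : h ⟂ x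
    h⟂ = polar-⟂ x M₁ (transversal wL₁)

    k : Pt
    k = polar-point z N₁ (transversal wK₁)

    k∈ : k ∈ₗ N₁
    k∈ = polar-∈ z N₁ (transversal wK₁)

    k⟂ : k ⟂ z
    k⟂ = polar-⟂ z N₁ (transversal wK₁)

    shared-shared : ∀ {b₂ c₂ M₂ N₂} → b₂ ≐ₚ x → h ∈ₗ M₂ → c₂ ≐ₚ z → k ∈ₗ N₂ →
      Crossing x M₁ z N₁ → Crossing x M₁ c₂ N₂ → Crossing b₂ M₂ z N₁ → Crossing b₂ M₂ c₂ N₂
    shared-shared b₂≐x hM₂ c₂≐z kN₂ (inj₁ p₁₁@(x≐z , _)) p₁₂ p₂₁ =
      inj₁ (plane-crossing h∈ hM₂ h⟂ k∈ kN₂ (⟂-resp ≐refl x≐z k⟂) b₂≐x p₁₁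
              (crossing-of-⟂-bases (⟂-of-≐ (≐trans c₂≐z (≐sym x≐z))) p₁₂)
              (crossing-of-⟂-bases (⟂-of-≐ (≐sym (≐trans b₂≐x x≐z))) p₂₁))
    shared-shared b₂≐x hM₂ c₂≐z kN₂ (inj₂ (_ , _ , x⟂̸z)) p₁₂ p₂₁ =
      inj₂ (∈ₗ-resp b₂≐x xN₂ , ∈ₗ-resp c₂≐z zM₂ , ¬⟂-resp (≐sym b₂≐x) (≐sym c₂≐z) x⟂̸z)
      where
      xN₂ : x ∈ₗ _
      xN₂ = proj₁ (crossing-of-distinct-bases (λ x≐c₂ → ≠-of-¬⟂ x⟂̸z (≐sym (≐trans x≐c₂ c₂≐z))) p₁₂)
      zM₂ : z ∈ₗ _
      zM₂ = proj₁ (proj₂ (crossing-of-distinct-bases (λ b₂≐z → ≠-of-¬⟂ x⟂̸z (≐trans (≐sym b₂≐z) b₂≐x)) p₂₁))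

    swapped-shared : ∀ {b₂ c₂ M₂ N₂} → b₂ ≐ₚ h → x ∈ₗ M₂ → c₂ ≐ₚ z → k ∈ₗ N₂ →
      Crossing x M₁ z N₁ → Crossing x M₁ c₂ N₂ → Crossing b₂ M₂ z N₁ → Crossing b₂ M₂ c₂ N₂
    swapped-shared b₂≐h xM₂ c₂≐z kN₂ (inj₁ p₁₁@(x≐z , _)) p₁₂ p₂₁ =
      inj₁ (plane-crossing h∈ (∈ₗ-resp h≐x xM₂) h⟂ k∈ kN₂ (⟂-resp ≐refl x≐z k⟂) (≐trans b₂≐z (≐sym x≐z)) p₁₁
              (crossing-of-⟂-bases (⟂-of-≐ (≐trans c₂≐z (≐sym x≐z))) p₁₂) p₂₁′)
      where
      p₂₁′ = crossing-of-⟂-bases (⟂-resp b₂≐h (≐sym x≐z) h⟂) p₂₁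
      b₂≐z = proj₁ p₂₁′
      -- h is the base of L₂, which equals z and hence x
      h≐x : h ≐ₚ x
      h≐x = ≐trans (≐sym b₂≐h) (≐trans b₂≐z (≐sym x≐z))
    swapped-shared b₂≐h xM₂ c₂≐z kN₂ (inj₂ (xN₁ , _ , x⟂̸z)) p₁₂ p₂₁ =
      inj₂ (b₂N₂ , ∈ₗ-resp c₂≐z zM₂ , ¬⟂-resp ≐refl (≐sym c₂≐z) b₂⟂̸z)
      where
      xN₂ = proj₁ (crossing-of-distinct-bases (λ x≐c₂ → ≠-of-¬⟂ x⟂̸z (≐sym (≐trans x≐c₂ c₂≐z))) p₁₂)
      p₂₁′ = crossing-of-distinct-bases (λ b₂≐z → x⟂̸z (⟂-sym (⟂-resp (≐trans (≐sym b₂≐z) b₂≐h) ≐refl h⟂))) p₂₁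
      zM₂ = proj₁ (proj₂ p₂₁′)
      b₂⟂̸z = proj₂ (proj₂ p₂₁′)
      -- N₂ contains k and x, which span N₁ ∋ b₂
      b₂N₂ = ∈ₗ-of-two-points k∈ xN₁ (det-nonzero-separated k∈ xN₁ z k⟂ x⟂̸z) kN₂ xN₂ (proj₁ p₂₁′)

    -- L₂ = h ⊕ M₂ with x ∈ M₂, and K₂ = k ⊕ N₂ with z ∈ N₂.  Shared bases
    -- would make x + h = z + k, i.e. L₁ ∥ K₁; otherwise h = x and k = z.
    swapped-swapped : ∀ {b₂ c₂ M₂ N₂} → ¬ (x , h) ≑ₘ (z , k) → b₂ ≐ₚ h → x ∈ₗ M₂ → c₂ ≐ₚ k → z ∈ₗ N₂ →
      Crossing x M₁ z N₁ → Crossing x M₁ c₂ N₂ → Crossing b₂ M₂ z N₁ → Crossing b₂ M₂ c₂ N₂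
    swapped-swapped L₁∦K₁ b₂≐h xM₂ c₂≐k zN₂ (inj₁ (x≐z , _)) p₁₂ p₂₁ =
      ⊥-elim (L₁∦K₁ (inj₁ (x≐z , ≐trans (≐sym b₂≐h) (≐trans b₂≐z (≐trans (≐sym x≐z) (≐trans x≐c₂ c₂≐k))))))
      where
      x≐c₂ = proj₁ (crossing-of-⟂-bases (⟂-resp x≐z c₂≐k (⟂-sym k⟂)) p₁₂)
      b₂≐z = proj₁ (crossing-of-⟂-bases (⟂-resp b₂≐h (≐sym x≐z) h⟂) p₂₁)
    swapped-swapped L₁∦K₁ b₂≐h xM₂ c₂≐k zN₂ (inj₂ (xN₁ , zM₁ , x⟂̸z)) p₁₂ p₂₁ =
      inj₂ (∈ₗ-resp (≐trans b₂≐h h≐x) xN₂ , ∈ₗ-resp (≐trans c₂≐k k≐z) zM₂ ,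
            ¬⟂-resp (≐sym (≐trans b₂≐h h≐x)) (≐sym (≐trans c₂≐k k≐z)) x⟂̸z)
      where
      p₁₂′ = crossing-of-distinct-bases (λ x≐c₂ → x⟂̸z (⟂-resp (≐trans x≐c₂ c₂≐k) ≐refl k⟂)) p₁₂
      p₂₁′ = crossing-of-distinct-bases (λ b₂≐z → x⟂̸z (⟂-sym (⟂-resp (≐trans (≐sym b₂≐z) b₂≐h) ≐refl h⟂))) p₂₁
      xN₂ = proj₁ p₁₂′
      zM₂ = proj₁ (proj₂ p₂₁′)
      -- k and z are points of M₁ orthogonal to z, h and x points of N₁ orthogonal to x
      k≐z : k ≐ₚ z
      k≐z = ⟂-unique zM₁ h∈ (⟂-self z) (λ h⟂z → proj₂ (proj₂ p₂₁′) (⟂-resp b₂≐h ≐refl h⟂z))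
              (∈ₗ-resp (≐sym c₂≐k) (proj₁ (proj₂ p₁₂′))) k⟂
      h≐x : h ≐ₚ x
      h≐x = ⟂-unique xN₁ k∈ (⟂-self x) (λ k⟂x → proj₂ (proj₂ p₁₂′) (⟂-sym (⟂-resp c₂≐k ≐refl k⟂x)))
              (∈ₗ-resp (≐sym b₂≐h) (proj₁ p₂₁′)) h⟂

  parallelogram-completion : ParallelogramCompletion
  parallelogram-completion (double L , w) _ _ _ _ _ _ _ _ _ _ _ _ = ⊥-elim (double⊆ℋ {L} w)
  parallelogram-completion _ (double L , w) _ _ _ _ _ _ _ _ _ _ _ = ⊥-elim (double⊆ℋ {L} w)
  parallelogram-completion _ _ (double L , w) _ _ _ _ _ _ _ _ _ _ = ⊥-elim (double⊆ℋ {L} w)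
  parallelogram-completion _ _ _ (double L , w) _ _ _ _ _ _ _ _ _ = ⊥-elim (double⊆ℋ {L} w)
  parallelogram-completion ((x ⊕ M₁) , wL₁) ((b₂ ⊕ M₂) , wL₂) ((z ⊕ N₁) , wK₁) ((c₂ ⊕ N₂) , wK₂)
                           L₁∥L₂ K₁∥K₂ L₁∦K₁ _ _ _ m₁₁ m₁₂ m₂₁ =
    meet-of-crossing {b₂} {M₂} {c₂} {N₂} {wL₂} {wK₂}
      (by-polar-sums (polar-sum-on {x} {M₁} {b₂} {M₂} wL₁ {wL₂} L₁∥L₂) (polar-sum-on {z} {N₁} {c₂} {N₂} wK₁ {wK₂} K₁∥K₂)
        (crossing-of-meet {x} {M₁} {z} {N₁} {wL₁} {wK₁} m₁₁) (crossing-of-meet {x} {M₁} {c₂} {N₂} {wL₁} {wK₂} m₁₂)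
        (crossing-of-meet {b₂} {M₂} {z} {N₁} {wL₂} {wK₁} m₂₁))
    where
    open Parallelogram wL₁ wK₁
    polar-sum-on : ∀ {b L c N} (w : Off-ℋ b L) {w′} → ((b ⊕ L) , w) ∥ ((c ⊕ N) , w′) →
                   (b , polar-point b L (transversal w)) ∈ᵥ (c ⊕ N)
    polar-sum-on {b} {L} {c} {N} w ∥ = ∈ᵥ-from {_} {c} {N}
      (proj₁ (∥ (polar-sum b L (transversal w)) (polar-sum-ℋ b L (transversal w))) (∈ᵥ-to {_} {b} {L} (polar-sum-∈ b L (transversal w))))
    L₁∦K₁′ : ¬ (x , h) ≑ₘ (z , k)
    L₁∦K₁′ E = L₁∦K₁ (parallel-of-polar-sum {x} {M₁} {z} {N₁} wL₁ wK₁ E)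
    by-polar-sums : (x , h) ∈ᵥ (b₂ ⊕ M₂) → (z , k) ∈ᵥ (c₂ ⊕ N₂) →
      Crossing x M₁ z N₁ → Crossing x M₁ c₂ N₂ → Crossing b₂ M₂ z N₁ → Crossing b₂ M₂ c₂ N₂
    by-polar-sums (mk∈ᵥ _ m∈ (inj₁ (x≐b₂ , h≐m))) (mk∈ᵥ _ n∈ (inj₁ (z≐c₂ , k≐n))) =
      shared-shared (≐sym x≐b₂) (∈ₗ-resp h≐m m∈) (≐sym z≐c₂) (∈ₗ-resp k≐n n∈)
    by-polar-sums (mk∈ᵥ _ m∈ (inj₂ (x≐m , h≐b₂))) (mk∈ᵥ _ n∈ (inj₁ (z≐c₂ , k≐n))) =
      swapped-shared (≐sym h≐b₂) (∈ₗ-resp x≐m m∈) (≐sym z≐c₂) (∈ₗ-resp k≐n n∈)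
    by-polar-sums (mk∈ᵥ _ m∈ (inj₁ (x≐b₂ , h≐m))) (mk∈ᵥ _ n∈ (inj₂ (z≐n , k≐c₂))) p₁₁ p₁₂ p₂₁ =
      crossing-sym (Parallelogram.swapped-shared wK₁ wL₁ (≐sym k≐c₂) (∈ₗ-resp z≐n n∈) (≐sym x≐b₂) (∈ₗ-resp h≐m m∈)
                     (crossing-sym p₁₁) (crossing-sym p₂₁) (crossing-sym p₁₂))
    by-polar-sums (mk∈ᵥ _ m∈ (inj₂ (x≐m , h≐b₂))) (mk∈ᵥ _ n∈ (inj₂ (z≐n , k≐c₂))) =
      swapped-swapped L₁∦K₁′ (≐sym h≐b₂) (∈ₗ-resp x≐m m∈) (≐sym k≐c₂) (∈ₗ-resp z≐n n∈)


-- Proposition 2.11.  Both conditions follow from the lemmas of Geometry.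
proposition2p11 : ∀ {r ℓr m ℓm : Level} (R : CommutativeRing r ℓr) → IsField R → CharNot2 R →
    (M : Module R m ℓm) →
    (σ : CommutativeRing.Carrier R → CommutativeRing.Carrier R) → IsFieldAutomorphism R σ →
    (ξ : Module.Carrierᴹ M → Module.Carrierᴹ M → CommutativeRing.Carrier R) →
    IsSesquilinear R M σ ξ → IsReflexiveForm R M ξ → IsNonzeroForm R M ξ →
    Reduct.IsSymplectic R M ξ →
    Reduct.TamaschkeBedingung R M ξ × Reduct.ParallelogramCompletion R M ξ
proposition2p11 R isField _ M σ _ ξ sesquilinear reflexive _ symplectic =
  tamaschke , parallelogram-completion
  where open Geometry R isField M σ ξ sesquilinear reflexive symplectic
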